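{- For any $R,S,T\in\mathbb{Q}$, \begin{align*} &\operatorname{Diag}\big((1-x)^R(1-x-y)^S(1-x-y-z)^T\big)=\\ &{}_6F_5\Big(\Big[\tfrac{ -(R+S+T)}{3},\tfrac{1-(R+S+T)}{3},\tfrac{2-(R+S+T)}{3},\tfrac{ -(S+T)}{2},\tfrac{1-(S+T)}{2},-T\Big];\Big[\tfrac{ -(R+S+T)}{2},\tfrac{1-(R+S+T)}{2},-(S+T),1,1\Big];27t\Big) \end{align*} and \begin{align*} &\operatorname{Diag}\big((1-x)^R(1-x-2y)^S(1-x-y-z)^{ -1}\big)=\\ &{}_4F_3\Big(\Big[\tfrac{1-(R+S)}{3},\tfrac{2-(R+S)}{3},\tfrac{3-(R+S)}{3},\tfrac{1-S}{2}\Big];\Big[\tfrac{1-(R+S)}{2},\tfrac{2-(R+S)}{2},1\Big];27t\Big). \end{align*}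
   Context: All power series have coefficients in $\mathbb{Q}$. For $a\in\mathbb{Q}$ and a power series $L$ with zero constant term, $(1+L)^a:=\sum_{j\ge0}\binom{a}{j}L^j$, where $\binom{a}{j}=a(a-1)\cdots(a-j+1)/j!$. For $g=\sum g_{i,j,k}x^iy^jz^k$, $\operatorname{Diag}(g):=\sum_{m\ge0}g_{m,m,m}t^m$. The generalized hypergeometric function is ${}_pF_q([a_1,\dots,a_p];[b_1,\dots,b_q];t):=\sum_{j\ge0}\frac{(a_1)_j\cdots(a_p)_j}{(b_1)_j\cdots(b_q)_j}\frac{t^j}{j!}$ with $(x)_j=x(x+1)\cdots(x+j-1)$, defined when no $b_i+j$ ($j\in\mathbb{N}$) vanishes. -}

module Defs where

open import Data.Nat as ℕ using (ℕ; zero; suc)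
open import Data.Integer using (+_)
open import Data.Rational using (ℚ; 0ℚ; 1ℚ; _+_; _*_; _-_; -_; _÷_; _/_; ≢-nonZero)
open import Data.Rational.Properties using (_≟_)
open import Data.List using (List; map; foldr)
open import Data.List.Relation.Unary.All using (All)
open import Relation.Nullary using (yes; no)
open import Relation.Binary.PropositionalEquality using (_≢_)

ι : ℕ → ℚ
ι n = (+ n) / 1

-- total division (only ever used where the denominator is nonzero)
_÷'_ : ℚ → ℚ → ℚ
p ÷' q with q ≟ 0ℚ
... | yes _ = 0ℚ
... | no q≢0 = _÷_ p q {{≢-nonZero q≢0}}

sumTo : ℕ → (ℕ → ℚ) → ℚ
sumTo zero    f = f 0
sumTo (suc n) f = sumTo n f + f (suc n)

prodL : List ℚ → ℚ
prodL = foldr _*_ 1ℚ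

fact : ℕ → ℚ
fact zero    = 1ℚ
fact (suc n) = fact n * ι (suc n)

falling : ℚ → ℕ → ℚ
falling a zero    = 1ℚ
falling a (suc j) = falling a j * (a - ι j)

binomQ : ℚ → ℕ → ℚ
binomQ a j = falling a j ÷' fact j

poch : ℚ → ℕ → ℚ
poch a zero    = 1ℚ
poch a (suc j) = poch a j * (a + ι j)

-- Formal power series in x,y,z : coefficient of x^i y^j z^k

Series3 : Set
Series3 = ℕ → ℕ → ℕ → ℚ

-- univariate formal power series in t : coefficient of t^m
Series1 : Set
Series1 = ℕ → ℚ

zero3 : Series3
zero3 _ _ _ = 0ℚ

one3 : Series3
one3 zero zero zero = 1ℚ
one3 _    _    _    = 0ℚ

X Y Z : Series3
X 1 zero zero = 1ℚ
X _ _    _    = 0ℚ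
Y zero 1 zero = 1ℚ
Y _    _ _    = 0ℚ
Z zero zero 1 = 1ℚ
Z _    _    _ = 0ℚ

_⊕_ : Series3 → Series3 → Series3
(f ⊕ g) i j k = f i j k + g i j k

_⊖_ : Series3 → Series3 → Series3
(f ⊖ g) i j k = f i j k - g i j k

scale : ℚ → Series3 → Series3
scale c f i j k = c * f i j k

_⊗_ : Series3 → Series3 → Series3
(f ⊗ g) i j k =
  sumTo i (λ a → sumTo j (λ b → sumTo k (λ c →
    f a b c * g (i ℕ.∸ a) (j ℕ.∸ b) (k ℕ.∸ c))))

pow3 : Series3 → ℕ → Series3
pow3 L zero    = one3
pow3 L (suc n) = pow3 L n ⊗ L

-- (1+L)^a := Σ_j binom(a,j) L^j, for L with zero constant term.
-- Since L has zero constant term, L^j contributes nothing to the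
-- coefficient of x^i y^j z^k once j > i+j+k, so the sum is finite.
onePlusPow : Series3 → ℚ → Series3
onePlusPow L a i j k = sumTo (i ℕ.+ j ℕ.+ k) (λ n → binomQ a n * pow3 L n i j k)

Diag : Series3 → Series1
Diag g m = g m m m

-- Generalized hypergeometric series pFq(as; bs; c t) as a series in t:
-- coefficient of t^j is  Π(a)_j / (Π(b)_j j!) * c^j.

hypCoeff : List ℚ → List ℚ → ℕ → ℚ
hypCoeff as bs j = prodL (map (λ a → poch a j) as) ÷' (prodL (map (λ b → poch b j) bs) * fact j)

powQ : ℚ → ℕ → ℚ
powQ c zero    = 1ℚ
powQ c (suc n) = powQ c n * c

HypF : List ℚ → List ℚ → ℚ → Series1
HypF as bs c j = hypCoeff as bs j * powQ c j

HypDefined : List ℚ → Set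
HypDefined bs = All (λ b → (j : ℕ) → b + ι j ≢ 0ℚ) bs

{-# OPTIONS --safe #-}
module Submission where

-- The factor (1 − x − βy − γz)^a has coefficient (−a)_{i+j+k} β^j γ^k / (i! j! k!) at x^i y^j z^k.
-- In the diagonal coefficient of the product, two Chu–Vandermonde summations
-- Σ_{k+e=n} (x)_k (y)_e / (k! e!) = (x + y)_n / n! leave
--   (−R−S−T+2m)_m / m!² · Σ_{b+e=m} (−S)_b β^b (−T)_{m+e} / (b! e!).
-- For β = 1 a third Chu–Vandermonde summation evaluates the last sum to (−T)_m (−S−T+m)_m / m!;
-- for β = 2 and T = −1 it equals 4^m ((1−S)/2)_m, by a WZ recurrence.  The duplication and
-- triplication formulas (x)_{2m} = 4^m (x/2)_m ((x+1)/2)_m and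
-- (x)_{3m} = 27^m (x/3)_m ((x+1)/3)_m ((x+2)/3)_m turn these products into the
-- hypergeometric coefficients.

open import Data.Nat as ℕ using (ℕ; zero; suc; _≤_; _<_; z≤n; s≤s; _∸_)
import Data.Nat.Properties as ℕP
import Data.Nat.Coprimality as Coprime
open import Data.Integer as ℤ using (+_)
import Data.Integer.Properties as ℤP
open import Data.Rational using (ℚ; 0ℚ; 1ℚ; mkℚ; _+_; _*_; _-_; -_; _/_; 1/_; ≢-nonZero)
import Data.Rational.Properties as ℚP
open import Data.Rational.Solver using (module +-*-Solver)
open import Data.List using ([]; _∷_; map)
open import Data.List.Relation.Unary.All using ([]; _∷_)
open import Data.Product using (_×_; _,_)
open import Data.Empty using (⊥-elim)
open import Function using (_∘_)
open import Relation.Nullary using (yes; no)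
open import Relation.Binary.PropositionalEquality
open import Defs
open +-*-Solver

ι≡mkℚ : ∀ n → ι n ≡ mkℚ (+ n) 0 (Coprime.sym (Coprime.1-coprimeTo n))
ι≡mkℚ n = ℚP.normalize-coprime (Coprime.sym (Coprime.1-coprimeTo n))

ι-suc : ∀ n → ι (suc n) ≡ ι n + 1ℚ
ι-suc n rewrite ι≡mkℚ n = cong (_/ 1)
  (trans (cong +_ (ℕP.+-comm 1 n)) (cong₂ ℤ._+_ (sym (ℤP.*-identityʳ (+ n))) refl))

ι-+ : ∀ m n → ι (m ℕ.+ n) ≡ ι m + ι n
ι-+ zero    n = sym (ℚP.+-identityˡ (ι n))
ι-+ (suc m) n = begin
  ι (suc (m ℕ.+ n))  ≡⟨ ι-suc (m ℕ.+ n) ⟩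
  ι (m ℕ.+ n) + 1ℚ   ≡⟨ cong (_+ 1ℚ) (ι-+ m n) ⟩
  ι m + ι n + 1ℚ     ≡⟨ solve 2 (λ a b → a :+ b :+ con 1ℚ := a :+ con 1ℚ :+ b) refl (ι m) (ι n) ⟩
  ι m + 1ℚ + ι n     ≡⟨ cong (_+ ι n) (sym (ι-suc m)) ⟩
  ι (suc m) + ι n    ∎
  where open ≡-Reasoning

ι-suc≢0 : ∀ n → ι (suc n) ≢ 0ℚ
ι-suc≢0 n eq with trans (sym (ι≡mkℚ (suc n))) eq
... | ()

*-≢0 : ∀ {p q} → p ≢ 0ℚ → q ≢ 0ℚ → p * q ≢ 0ℚ
*-≢0 {p} {q} p≢0 q≢0 pq≡0 = q≢0 (begin
  q                  ≡⟨ sym (ℚP.*-identityˡ q) ⟩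
  1ℚ * q             ≡⟨ cong (_* q) (sym (ℚP.*-inverseˡ p)) ⟩
  1/ p * p * q       ≡⟨ ℚP.*-assoc (1/ p) p q ⟩
  1/ p * (p * q)     ≡⟨ cong (1/ p *_) pq≡0 ⟩
  1/ p * 0ℚ          ≡⟨ ℚP.*-zeroʳ (1/ p) ⟩
  0ℚ                 ∎)
  where
  open ≡-Reasoning
  instance _ = ≢-nonZero p≢0

*-cancelʳ-≢0 : ∀ {p q} r → r ≢ 0ℚ → p * r ≡ q * r → p ≡ q
*-cancelʳ-≢0 {p} {q} r r≢0 eq = begin
  p                 ≡⟨ sym (ℚP.*-identityʳ p) ⟩
  p * 1ℚ            ≡⟨ cong (p *_) (sym (ℚP.*-inverseʳ r)) ⟩
  p * (r * 1/ r)    ≡⟨ sym (ℚP.*-assoc p r _) ⟩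
  p * r * 1/ r      ≡⟨ cong (_* 1/ r) eq ⟩
  q * r * 1/ r      ≡⟨ ℚP.*-assoc q r _ ⟩
  q * (r * 1/ r)    ≡⟨ cong (q *_) (ℚP.*-inverseʳ r) ⟩
  q * 1ℚ            ≡⟨ ℚP.*-identityʳ q ⟩
  q                 ∎
  where
  open ≡-Reasoning
  instance _ = ≢-nonZero r≢0

p÷'q*q≡p : ∀ p q → q ≢ 0ℚ → (p ÷' q) * q ≡ p
p÷'q*q≡p p q q≢0 with q ℚP.≟ 0ℚ
... | yes q≡0 = ⊥-elim (q≢0 q≡0)
... | no q≢0′ = begin
  p * 1/ q * q      ≡⟨ ℚP.*-assoc p _ q ⟩
  p * (1/ q * q)    ≡⟨ cong (p *_) (ℚP.*-inverseˡ q) ⟩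
  p * 1ℚ            ≡⟨ ℚP.*-identityʳ p ⟩
  p                 ∎
  where
  open ≡-Reasoning
  instance _ = ≢-nonZero q≢0′

x*q≡p*c⇒x≡p÷'q*c : ∀ {x} p q c → q ≢ 0ℚ → x * q ≡ p * c → x ≡ (p ÷' q) * c
x*q≡p*c⇒x≡p÷'q*c {x} p q c q≢0 eq = *-cancelʳ-≢0 q q≢0 (begin
  x * q                ≡⟨ eq ⟩
  p * c                ≡⟨ cong (_* c) (sym (p÷'q*q≡p p q q≢0)) ⟩
  (p ÷' q) * q * c     ≡⟨ solve 3 (λ a b d → a :* b :* d := a :* d :* b) refl (p ÷' q) q c ⟩
  (p ÷' q) * c * q     ∎)
  where open ≡-Reasoning

fact≢0 : ∀ n → fact n ≢ 0ℚ
fact≢0 zero    ()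
fact≢0 (suc n) = *-≢0 (fact≢0 n) (ι-suc≢0 n)

fact⁻¹ : ℕ → ℚ
fact⁻¹ n = 1ℚ ÷' fact n

fact⁻¹*fact≡1 : ∀ n → fact⁻¹ n * fact n ≡ 1ℚ
fact⁻¹*fact≡1 n = p÷'q*q≡p 1ℚ (fact n) (fact≢0 n)

fact⁻¹-suc : ∀ n → fact⁻¹ (suc n) * ι (suc n) ≡ fact⁻¹ n
fact⁻¹-suc n = *-cancelʳ-≢0 (fact n) (fact≢0 n) (begin
  fact⁻¹ (suc n) * ι (suc n) * fact n   ≡⟨ ℚP.*-assoc (fact⁻¹ (suc n)) (ι (suc n)) (fact n) ⟩
  fact⁻¹ (suc n) * (ι (suc n) * fact n) ≡⟨ cong (fact⁻¹ (suc n) *_) (ℚP.*-comm (ι (suc n)) (fact n)) ⟩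
  fact⁻¹ (suc n) * fact (suc n)         ≡⟨ fact⁻¹*fact≡1 (suc n) ⟩
  1ℚ                                    ≡⟨ sym (fact⁻¹*fact≡1 n) ⟩
  fact⁻¹ n * fact n                     ∎)
  where open ≡-Reasoning

powQ-+ : ∀ c m n → powQ c (m ℕ.+ n) ≡ powQ c m * powQ c n
powQ-+ c zero    n = sym (ℚP.*-identityˡ (powQ c n))
powQ-+ c (suc m) n = trans (cong (_* c) (powQ-+ c m n))
  (solve 3 (λ a b x → a :* b :* x := a :* x :* b) refl (powQ c m) (powQ c n) c)

powQ-* : ∀ x y n → powQ (x * y) n ≡ powQ x n * powQ y n
powQ-* x y zero    = refl
powQ-* x y (suc n) = trans (cong (_* (x * y)) (powQ-* x y n))
  (solve 4 (λ a b x y → a :* b :* (x :* y) := a :* x :* (b :* y)) refl (powQ x n) (powQ y n) x y)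

powQ-1 : ∀ n → powQ 1ℚ n ≡ 1ℚ
powQ-1 zero    = refl
powQ-1 (suc n) = cong (_* 1ℚ) (powQ-1 n)

sumTo-cong : ∀ n {f g : ℕ → ℚ} → (∀ i → i ≤ n → f i ≡ g i) → sumTo n f ≡ sumTo n g
sumTo-cong zero    f≗g = f≗g 0 z≤n
sumTo-cong (suc n) f≗g =
  cong₂ _+_ (sumTo-cong n (λ i i≤n → f≗g i (ℕP.m≤n⇒m≤1+n i≤n))) (f≗g (suc n) ℕP.≤-refl)

sumTo-distrib-+ : ∀ n (f g : ℕ → ℚ) → sumTo n (λ i → f i + g i) ≡ sumTo n f + sumTo n g
sumTo-distrib-+ zero    f g = refl
sumTo-distrib-+ (suc n) f g = trans (cong (_+ (f (suc n) + g (suc n))) (sumTo-distrib-+ n f g))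
  (solve 4 (λ a b c d → (a :+ b) :+ (c :+ d) := (a :+ c) :+ (b :+ d)) refl
     (sumTo n f) (sumTo n g) (f (suc n)) (g (suc n)))

sumTo-*ˡ : ∀ n c (f : ℕ → ℚ) → sumTo n (λ i → c * f i) ≡ c * sumTo n f
sumTo-*ˡ zero    c f = refl
sumTo-*ˡ (suc n) c f =
  trans (cong (_+ (c * f (suc n))) (sumTo-*ˡ n c f)) (sym (ℚP.*-distribˡ-+ c _ _))

sumTo-*ʳ : ∀ n c (f : ℕ → ℚ) → sumTo n (λ i → f i * c) ≡ sumTo n f * c
sumTo-*ʳ n c f =
  trans (sumTo-cong n (λ i _ → ℚP.*-comm (f i) c)) (trans (sumTo-*ˡ n c f) (ℚP.*-comm c _))

sumTo≡0 : ∀ n (f : ℕ → ℚ) → (∀ i → i ≤ n → f i ≡ 0ℚ) → sumTo n f ≡ 0ℚ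
sumTo≡0 zero    f f≡0 = f≡0 0 z≤n
sumTo≡0 (suc n) f f≡0 =
  cong₂ _+_ (sumTo≡0 n f (λ i i≤n → f≡0 i (ℕP.m≤n⇒m≤1+n i≤n))) (f≡0 (suc n) ℕP.≤-refl)

sumTo-suc-head : ∀ n (f : ℕ → ℚ) → sumTo (suc n) f ≡ f 0 + sumTo n (f ∘ suc)
sumTo-suc-head zero    f = refl
sumTo-suc-head (suc n) f = trans (cong (_+ f (suc (suc n))) (sumTo-suc-head n f))
  (ℚP.+-assoc (f 0) (sumTo n (f ∘ suc)) (f (suc (suc n))))

sumTo≡head : ∀ n (f : ℕ → ℚ) → (∀ i → f (suc i) ≡ 0ℚ) → sumTo n f ≡ f 0
sumTo≡head zero    f f≡0 = refl
sumTo≡head (suc n) f f≡0 = begin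
  sumTo (suc n) f          ≡⟨ sumTo-suc-head n f ⟩
  f 0 + sumTo n (f ∘ suc)  ≡⟨ cong (λ z → f 0 + z) (sumTo≡0 n (f ∘ suc) (λ i _ → f≡0 i)) ⟩
  f 0 + 0ℚ                 ≡⟨ ℚP.+-identityʳ (f 0) ⟩
  f 0                      ∎
  where open ≡-Reasoning

sumTo≡last : ∀ n (f : ℕ → ℚ) → (∀ i → i < n → f i ≡ 0ℚ) → sumTo n f ≡ f n
sumTo≡last zero    f f≡0 = refl
sumTo≡last (suc n) f f≡0 = trans (cong (_+ f (suc n)) (sumTo≡0 n f (λ i i≤n → f≡0 i (s≤s i≤n))))
  (ℚP.+-identityˡ (f (suc n)))

sumTo-comm : ∀ n m (f : ℕ → ℕ → ℚ) →
  sumTo n (λ i → sumTo m (f i)) ≡ sumTo m (λ j → sumTo n (λ i → f i j))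
sumTo-comm zero    m f = refl
sumTo-comm (suc n) m f = trans (cong (_+ sumTo m (f (suc n))) (sumTo-comm n m f))
  (sym (sumTo-distrib-+ m (λ j → sumTo n (λ i → f i j)) (f (suc n))))

sumTo-telescope : ∀ n (h : ℕ → ℚ) → sumTo n (λ i → h (suc i) - h i) ≡ h (suc n) - h 0
sumTo-telescope zero    h = refl
sumTo-telescope (suc n) h = trans (cong (_+ (h (suc (suc n)) - h (suc n))) (sumTo-telescope n h))
  (solve 3 (λ a b c → (b :- a) :+ (c :- b) := c :- a) refl (h 0) (h (suc n)) (h (suc (suc n))))

antidiagonal : ℕ → (ℕ → ℕ → ℚ) → ℚ
antidiagonal n f = sumTo n (λ k → f k (n ∸ k))

antidiagonal-cong : ∀ n {f g : ℕ → ℕ → ℚ} → (∀ k e → f k e ≡ g k e) →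
  antidiagonal n f ≡ antidiagonal n g
antidiagonal-cong n f≗g = sumTo-cong n (λ k _ → f≗g k _)

antidiagonal-distrib-+ : ∀ n (f g : ℕ → ℕ → ℚ) →
  antidiagonal n (λ k e → f k e + g k e) ≡ antidiagonal n f + antidiagonal n g
antidiagonal-distrib-+ n f g = sumTo-distrib-+ n _ _

antidiagonal-*ˡ : ∀ n c (f : ℕ → ℕ → ℚ) → antidiagonal n (λ k e → c * f k e) ≡ c * antidiagonal n f
antidiagonal-*ˡ n c f = sumTo-*ˡ n c _

antidiagonal-*ʳ : ∀ n c (f : ℕ → ℕ → ℚ) → antidiagonal n (λ k e → f k e * c) ≡ antidiagonal n f * c
antidiagonal-*ʳ n c f = sumTo-*ʳ n c _

antidiagonal-suc-head : ∀ n (f : ℕ → ℕ → ℚ) →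
  antidiagonal (suc n) f ≡ f 0 (suc n) + antidiagonal n (f ∘ suc)
antidiagonal-suc-head n f = sumTo-suc-head n (λ k → f k (suc n ∸ k))

antidiagonal-suc-last : ∀ n (f : ℕ → ℕ → ℚ) →
  antidiagonal (suc n) f ≡ antidiagonal n (λ k e → f k (suc e)) + f (suc n) 0
antidiagonal-suc-last n f = cong₂ _+_
  (sumTo-cong n (λ k k≤n → cong (f k) (ℕP.+-∸-assoc 1 k≤n)))
  (cong (f (suc n)) (ℕP.n∸n≡0 n))

antidiagonal-index-sum : ∀ n (f : ℕ → ℕ → ℕ → ℚ) →
  antidiagonal n (λ k e → f k e (k ℕ.+ e)) ≡ antidiagonal n (λ k e → f k e n)
antidiagonal-index-sum n f = sumTo-cong n (λ k k≤n → cong (f k (n ∸ k)) (ℕP.m+[n∸m]≡n k≤n))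

antidiagonal-index-sumℚ : ∀ n (f : ℕ → ℕ → ℚ → ℚ) →
  antidiagonal n (λ k e → f k e (ι k + ι e)) ≡ antidiagonal n (λ k e → f k e (ι n))
antidiagonal-index-sumℚ n f = trans (antidiagonal-cong n (λ k e → cong (f k e) (sym (ι-+ k e))))
  (antidiagonal-index-sum n (λ k e x → f k e (ι x)))

antidiagonal-comm : ∀ p m (f : ℕ → ℕ → ℕ → ℕ → ℚ) →
  antidiagonal p (λ a q → antidiagonal m (f a q)) ≡ antidiagonal m (λ b e → antidiagonal p (λ a q → f a q b e))
antidiagonal-comm p m f = sumTo-comm p m (λ a b → f a (p ∸ a) b (m ∸ b))

antidiagonal-weightˡ : ∀ n (f : ℕ → ℕ → ℚ) →
  antidiagonal (suc n) (λ k e → ι k * f k e) ≡ antidiagonal n (λ k e → ι (suc k) * f (suc k) e)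
antidiagonal-weightˡ n f = trans (antidiagonal-suc-head n (λ k e → ι k * f k e))
  (trans (cong (_+ antidiagonal n (λ k e → ι (suc k) * f (suc k) e)) (ℚP.*-zeroˡ (f 0 (suc n))))
         (ℚP.+-identityˡ _))

antidiagonal-weightʳ : ∀ n (f : ℕ → ℕ → ℚ) →
  antidiagonal (suc n) (λ k e → ι e * f k e) ≡ antidiagonal n (λ k e → ι (suc e) * f k (suc e))
antidiagonal-weightʳ n f = trans (antidiagonal-suc-last n (λ k e → ι e * f k e))
  (trans (cong (λ z → antidiagonal n (λ k e → ι (suc e) * f k (suc e)) + z) (ℚP.*-zeroˡ (f (suc n) 0)))
         (ℚP.+-identityʳ _))

-- Pochhammer symbols

poch-+ : ∀ x p q → poch x (p ℕ.+ q) ≡ poch x p * poch (x + ι p) q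
poch-+ x p zero rewrite ℕP.+-identityʳ p = sym (ℚP.*-identityʳ (poch x p))
poch-+ x p (suc q) rewrite ℕP.+-suc p q = begin
  poch x (p ℕ.+ q) * (x + ι (p ℕ.+ q))
    ≡⟨ cong₂ _*_ (poch-+ x p q) (cong (λ z → x + z) (ι-+ p q)) ⟩
  poch x p * poch (x + ι p) q * (x + (ι p + ι q))
    ≡⟨ solve 5 (λ a b c d e → a :* b :* (c :+ (d :+ e)) := a :* (b :* (c :+ d :+ e))) refl
         (poch x p) (poch (x + ι p) q) x (ι p) (ι q) ⟩
  poch x p * (poch (x + ι p) q * (x + ι p + ι q))
    ∎
  where open ≡-Reasoning

poch-1 : ∀ m → poch 1ℚ m ≡ fact m
poch-1 zero    = refl
poch-1 (suc m) = cong₂ _*_ (poch-1 m) (trans (ℚP.+-comm 1ℚ (ι m)) (sym (ι-suc m)))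

poch≢0 : ∀ b m → (∀ j → b + ι j ≢ 0ℚ) → poch b m ≢ 0ℚ
poch≢0 b zero    b+j≢0 ()
poch≢0 b (suc m) b+j≢0 = *-≢0 (poch≢0 b m b+j≢0) (b+j≢0 m)

falling*[-1]^n≡poch : ∀ a n → falling a n * powQ (- 1ℚ) n ≡ poch (- a) n
falling*[-1]^n≡poch a zero    = refl
falling*[-1]^n≡poch a (suc n) = begin
  falling a n * (a - ι n) * (powQ (- 1ℚ) n * - 1ℚ)
    ≡⟨ solve 4 (λ F x i P → F :* (x :- i) :* (P :* (:- con 1ℚ)) := F :* P :* (:- x :+ i)) refl
         (falling a n) a (ι n) (powQ (- 1ℚ) n) ⟩
  falling a n * powQ (- 1ℚ) n * (- a + ι n)
    ≡⟨ cong (_* (- a + ι n)) (falling*[-1]^n≡poch a n) ⟩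
  poch (- a) n * (- a + ι n)
    ∎
  where open ≡-Reasoning

poch/fact : ℚ → ℕ → ℚ
poch/fact x k = poch x k * fact⁻¹ k

poch/fact-suc : ∀ x k → ι (suc k) * poch/fact x (suc k) ≡ (x + ι k) * poch/fact x k
poch/fact-suc x k = begin
  ι (suc k) * (poch x k * (x + ι k) * fact⁻¹ (suc k))
    ≡⟨ solve 4 (λ a b c d → a :* (b :* c :* d) := c :* b :* (d :* a)) refl
         (ι (suc k)) (poch x k) (x + ι k) (fact⁻¹ (suc k)) ⟩
  (x + ι k) * poch x k * (fact⁻¹ (suc k) * ι (suc k))
    ≡⟨ cong ((x + ι k) * poch x k *_) (fact⁻¹-suc k) ⟩
  (x + ι k) * poch x k * fact⁻¹ k
    ≡⟨ ℚP.*-assoc (x + ι k) (poch x k) (fact⁻¹ k) ⟩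
  (x + ι k) * poch/fact x k
    ∎
  where open ≡-Reasoning

chu-vandermonde : ∀ x y n → antidiagonal n (λ k e → poch/fact x k * poch/fact y e) ≡ poch/fact (x + y) n
chu-vandermonde x y zero    = refl
chu-vandermonde x y (suc n) = *-cancelʳ-≢0 (ι (suc n)) (ι-suc≢0 n) (begin
  C (suc n) * ι (suc n)
    ≡⟨ ℚP.*-comm (C (suc n)) (ι (suc n)) ⟩
  ι (suc n) * C (suc n)
    ≡⟨ sym (trans (antidiagonal-index-sumℚ (suc n) (λ k e w → w * F k e)) (antidiagonal-*ˡ (suc n) (ι (suc n)) F)) ⟩
  antidiagonal (suc n) (λ k e → (ι k + ι e) * F k e)
    ≡⟨ trans (antidiagonal-cong (suc n) (λ k e → ℚP.*-distribʳ-+ (F k e) (ι k) (ι e)))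
             (antidiagonal-distrib-+ (suc n) (λ k e → ι k * F k e) (λ k e → ι e * F k e)) ⟩
  antidiagonal (suc n) (λ k e → ι k * F k e) + antidiagonal (suc n) (λ k e → ι e * F k e)
    ≡⟨ cong₂ _+_ (trans (antidiagonal-weightˡ n F) (antidiagonal-cong n raiseˡ))
                 (trans (antidiagonal-weightʳ n F) (antidiagonal-cong n raiseʳ)) ⟩
  antidiagonal n (λ k e → (x + ι k) * F k e) + antidiagonal n (λ k e → (y + ι e) * F k e)
    ≡⟨ sym (antidiagonal-distrib-+ n (λ k e → (x + ι k) * F k e) (λ k e → (y + ι e) * F k e)) ⟩
  antidiagonal n (λ k e → (x + ι k) * F k e + (y + ι e) * F k e)
    ≡⟨ antidiagonal-cong n (λ k e → solve 5 (λ x y k e f → (x :+ k) :* f :+ (y :+ e) :* f := (x :+ y :+ (k :+ e)) :* f)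
         refl x y (ι k) (ι e) (F k e)) ⟩
  antidiagonal n (λ k e → (x + y + (ι k + ι e)) * F k e)
    ≡⟨ trans (antidiagonal-index-sumℚ n (λ k e w → (x + y + w) * F k e)) (antidiagonal-*ˡ n (x + y + ι n) F) ⟩
  (x + y + ι n) * C n
    ≡⟨ cong ((x + y + ι n) *_) (chu-vandermonde x y n) ⟩
  (x + y + ι n) * poch/fact (x + y) n
    ≡⟨ sym (poch/fact-suc (x + y) n) ⟩
  ι (suc n) * poch/fact (x + y) (suc n)
    ≡⟨ ℚP.*-comm (ι (suc n)) (poch/fact (x + y) (suc n)) ⟩
  poch/fact (x + y) (suc n) * ι (suc n)
    ∎)
  where
  open ≡-Reasoning
  F : ℕ → ℕ → ℚ
  F k e = poch/fact x k * poch/fact y e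
  C : ℕ → ℚ
  C n = antidiagonal n F
  raiseˡ : ∀ k e → ι (suc k) * F (suc k) e ≡ (x + ι k) * F k e
  raiseˡ k e = trans (sym (ℚP.*-assoc (ι (suc k)) _ _))
    (trans (cong (_* poch/fact y e) (poch/fact-suc x k)) (ℚP.*-assoc (x + ι k) _ _))
  raiseʳ : ∀ k e → ι (suc e) * F k (suc e) ≡ (y + ι e) * F k e
  raiseʳ k e = begin
    ι (suc e) * (poch/fact x k * poch/fact y (suc e))
      ≡⟨ solve 3 (λ a b c → a :* (b :* c) := b :* (a :* c)) refl (ι (suc e)) (poch/fact x k) (poch/fact y (suc e)) ⟩
    poch/fact x k * (ι (suc e) * poch/fact y (suc e))
      ≡⟨ cong (poch/fact x k *_) (poch/fact-suc y e) ⟩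
    poch/fact x k * ((y + ι e) * poch/fact y e)
      ≡⟨ solve 3 (λ a b c → b :* (a :* c) := a :* (b :* c)) refl (y + ι e) (poch/fact x k) (poch/fact y e) ⟩
    (y + ι e) * F k e
      ∎

poch-double : ∀ x h₁ h₂ → (+ 2 / 1) * h₁ ≡ x → (+ 2 / 1) * h₂ ≡ x + 1ℚ → ∀ m →
  poch x (m ℕ.+ m) ≡ powQ (+ 4 / 1) m * (poch h₁ m * poch h₂ m)
poch-double x h₁ h₂ e₁ e₂ zero    = refl
poch-double x h₁ h₂ e₁ e₂ (suc m) rewrite ℕP.+-suc m m = begin
  poch x (m ℕ.+ m) * (x + ι (m ℕ.+ m)) * (x + ι (suc (m ℕ.+ m)))
    ≡⟨ cong₂ (λ a b → a * (x + b) * (x + ι (suc (m ℕ.+ m)))) (poch-double x h₁ h₂ e₁ e₂ m) (ι-+ m m) ⟩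
  P * (x + (i + i)) * (x + ι (suc (m ℕ.+ m)))
    ≡⟨ cong (λ z → P * (x + (i + i)) * (x + z)) (trans (ι-suc (m ℕ.+ m)) (cong (_+ 1ℚ) (ι-+ m m))) ⟩
  P * (x + (i + i)) * (x + (i + i + 1ℚ))
    ≡⟨ cong₂ (λ a b → P * (a + (i + i)) * b) (sym e₁)
         (trans (solve 2 (λ x i → x :+ (i :+ i :+ con 1ℚ) := (x :+ con 1ℚ) :+ (i :+ i)) refl x i)
                (cong (_+ (i + i)) (sym e₂))) ⟩
  P * ((+ 2 / 1) * h₁ + (i + i)) * ((+ 2 / 1) * h₂ + (i + i))
    ≡⟨ solve 6 (λ F A B h₁ h₂ i → F :* (A :* B) :* (con (+ 2 / 1) :* h₁ :+ (i :+ i)) :* (con (+ 2 / 1) :* h₂ :+ (i :+ i))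
                 := F :* con (+ 4 / 1) :* (A :* (h₁ :+ i) :* (B :* (h₂ :+ i)))) refl
         (powQ (+ 4 / 1) m) (poch h₁ m) (poch h₂ m) h₁ h₂ i ⟩
  powQ (+ 4 / 1) m * (+ 4 / 1) * (poch h₁ m * (h₁ + i) * (poch h₂ m * (h₂ + i)))
    ∎
  where
  open ≡-Reasoning
  i = ι m
  P = powQ (+ 4 / 1) m * (poch h₁ m * poch h₂ m)

poch-triple : ∀ x h₁ h₂ h₃ →
  (+ 3 / 1) * h₁ ≡ x → (+ 3 / 1) * h₂ ≡ x + 1ℚ → (+ 3 / 1) * h₃ ≡ x + (+ 2 / 1) → ∀ m →
  poch x (m ℕ.+ m ℕ.+ m) ≡ powQ (+ 27 / 1) m * (poch h₁ m * poch h₂ m * poch h₃ m)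
poch-triple x h₁ h₂ h₃ e₁ e₂ e₃ zero    = refl
poch-triple x h₁ h₂ h₃ e₁ e₂ e₃ (suc m) = trans (cong (poch x) 3[1+m]≡3+3m) (begin
  poch x M * (x + ι M) * (x + ι (suc M)) * (x + ι (suc (suc M)))
    ≡⟨ cong (λ a → a * (x + j) * (x + ι (suc M)) * (x + ι (suc (suc M)))) (poch-triple x h₁ h₂ h₃ e₁ e₂ e₃ m) ⟩
  P * (x + j) * (x + ι (suc M)) * (x + ι (suc (suc M)))
    ≡⟨ cong₂ (λ a b → P * (x + j) * (x + a) * (x + b)) (ι-suc M) (trans (ι-suc (suc M)) (cong (_+ 1ℚ) (ι-suc M))) ⟩
  P * (x + j) * (x + (j + 1ℚ)) * (x + (j + 1ℚ + 1ℚ))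
    ≡⟨ cong₂ (λ a b → P * (a + j) * b * (x + (j + 1ℚ + 1ℚ))) (sym e₁)
         (trans (solve 2 (λ x j → x :+ (j :+ con 1ℚ) := (x :+ con 1ℚ) :+ j) refl x j) (cong (_+ j) (sym e₂))) ⟩
  P * ((+ 3 / 1) * h₁ + j) * ((+ 3 / 1) * h₂ + j) * (x + (j + 1ℚ + 1ℚ))
    ≡⟨ cong (P * ((+ 3 / 1) * h₁ + j) * ((+ 3 / 1) * h₂ + j) *_)
         (trans (solve 2 (λ x j → x :+ (j :+ con 1ℚ :+ con 1ℚ) := (x :+ con (+ 2 / 1)) :+ j) refl x j)
                (cong (_+ j) (sym e₃))) ⟩
  P * ((+ 3 / 1) * h₁ + j) * ((+ 3 / 1) * h₂ + j) * ((+ 3 / 1) * h₃ + j)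
    ≡⟨ cong (λ z → P * ((+ 3 / 1) * h₁ + z) * ((+ 3 / 1) * h₂ + z) * ((+ 3 / 1) * h₃ + z)) j≡3i ⟩
  P * ((+ 3 / 1) * h₁ + (i + i + i)) * ((+ 3 / 1) * h₂ + (i + i + i)) * ((+ 3 / 1) * h₃ + (i + i + i))
    ≡⟨ solve 8 (λ F A B C h₁ h₂ h₃ i →
          F :* (A :* B :* C) :* (con (+ 3 / 1) :* h₁ :+ (i :+ i :+ i)) :* (con (+ 3 / 1) :* h₂ :+ (i :+ i :+ i))
            :* (con (+ 3 / 1) :* h₃ :+ (i :+ i :+ i))
          := F :* con (+ 27 / 1) :* (A :* (h₁ :+ i) :* (B :* (h₂ :+ i)) :* (C :* (h₃ :+ i)))) refl
         (powQ (+ 27 / 1) m) (poch h₁ m) (poch h₂ m) (poch h₃ m) h₁ h₂ h₃ i ⟩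
  powQ (+ 27 / 1) m * (+ 27 / 1) * (poch h₁ m * (h₁ + i) * (poch h₂ m * (h₂ + i)) * (poch h₃ m * (h₃ + i)))
    ∎)
  where
  open ≡-Reasoning
  M = m ℕ.+ m ℕ.+ m
  i = ι m
  j = ι M
  P = powQ (+ 27 / 1) m * (poch h₁ m * poch h₂ m * poch h₃ m)
  3[1+m]≡3+3m : suc m ℕ.+ suc m ℕ.+ suc m ≡ suc (suc (suc M))
  3[1+m]≡3+3m = cong suc (trans (cong (ℕ._+ suc m) (ℕP.+-suc m m)) (ℕP.+-suc (suc (m ℕ.+ m)) m))
  j≡3i : j ≡ i + i + i
  j≡3i = trans (ι-+ (m ℕ.+ m) m) (cong (_+ i) (ι-+ m m))

poch-upper-third : ∀ x g₁ g₂ g₃ h₁ h₂ →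
  (+ 3 / 1) * g₁ ≡ x → (+ 3 / 1) * g₂ ≡ x + 1ℚ → (+ 3 / 1) * g₃ ≡ x + (+ 2 / 1) →
  (+ 2 / 1) * h₁ ≡ x → (+ 2 / 1) * h₂ ≡ x + 1ℚ → ∀ m →
  poch (x + ι (m ℕ.+ m)) m * (powQ (+ 4 / 1) m * (poch h₁ m * poch h₂ m))
    ≡ powQ (+ 27 / 1) m * (poch g₁ m * poch g₂ m * poch g₃ m)
poch-upper-third x g₁ g₂ g₃ h₁ h₂ e₁ e₂ e₃ d₁ d₂ m = begin
  poch (x + ι (m ℕ.+ m)) m * (powQ (+ 4 / 1) m * (poch h₁ m * poch h₂ m))
    ≡⟨ cong (poch (x + ι (m ℕ.+ m)) m *_) (sym (poch-double x h₁ h₂ d₁ d₂ m)) ⟩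
  poch (x + ι (m ℕ.+ m)) m * poch x (m ℕ.+ m)
    ≡⟨ ℚP.*-comm (poch (x + ι (m ℕ.+ m)) m) (poch x (m ℕ.+ m)) ⟩
  poch x (m ℕ.+ m) * poch (x + ι (m ℕ.+ m)) m
    ≡⟨ sym (poch-+ x (m ℕ.+ m) m) ⟩
  poch x (m ℕ.+ m ℕ.+ m)
    ≡⟨ poch-triple x g₁ g₂ g₃ e₁ e₂ e₃ m ⟩
  powQ (+ 27 / 1) m * (poch g₁ m * poch g₂ m * poch g₃ m)
    ∎
  where open ≡-Reasoning

δ : ℕ → ℕ → ℚ
δ zero    zero    = 1ℚ
δ zero    (suc _) = 0ℚ
δ (suc _) zero    = 0ℚ
δ (suc m) (suc n) = δ m n

δ-refl : ∀ n → δ n n ≡ 1ℚ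
δ-refl zero    = refl
δ-refl (suc n) = δ-refl n

δ-≢ : ∀ {m n} → m ≢ n → δ m n ≡ 0ℚ
δ-≢ {zero}  {zero}  m≢n = ⊥-elim (m≢n refl)
δ-≢ {zero}  {suc n} _   = refl
δ-≢ {suc m} {zero}  _   = refl
δ-≢ {suc m} {suc n} m≢n = δ-≢ (m≢n ∘ cong suc)

δ-*-subst : ∀ m n (f : ℕ → ℚ) → δ m n * f n ≡ δ m n * f m
δ-*-subst zero    zero    f = refl
δ-*-subst zero    (suc n) f = trans (ℚP.*-zeroˡ (f (suc n))) (sym (ℚP.*-zeroˡ (f 0)))
δ-*-subst (suc m) zero    f = trans (ℚP.*-zeroˡ (f 0)) (sym (ℚP.*-zeroˡ (f (suc m))))
δ-*-subst (suc m) (suc n) f = δ-*-subst m n (f ∘ suc)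

sumTo-δ : ∀ n (f : ℕ → ℚ) → sumTo n (λ i → δ i n * f i) ≡ f n
sumTo-δ n f = trans
  (sumTo≡last n _ (λ i i<n → trans (cong (_* f i) (δ-≢ (ℕP.<⇒≢ i<n))) (ℚP.*-zeroˡ (f i))))
  (trans (cong (_* f n) (δ-refl n)) (ℚP.*-identityˡ (f n)))

shift : ℕ → (ℕ → ℚ) → ℕ → ℚ
shift zero    G n       = G n
shift (suc d) G zero    = 0ℚ
shift (suc d) G (suc n) = shift d G n

shift-cong : ∀ d n {G H : ℕ → ℚ} → (∀ a → G a ≡ H a) → shift d G n ≡ shift d H n
shift-cong zero    n       G≗H = G≗H n
shift-cong (suc d) zero    G≗H = refl
shift-cong (suc d) (suc n) G≗H = shift-cong d n G≗H

sumTo-*δ-∸ : ∀ d n (G : ℕ → ℚ) → sumTo n (λ a → G a * δ d (n ∸ a)) ≡ shift d G n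
sumTo-*δ-∸ zero    n       G = trans
  (sumTo≡last n _ (λ a a<n →
    trans (cong (G a *_) (δ-≢ (λ 0≡n∸a → ℕP.m>n⇒m∸n≢0 a<n (sym 0≡n∸a)))) (ℚP.*-zeroʳ (G a))))
  (trans (cong (λ z → G n * δ 0 z) (ℕP.n∸n≡0 n)) (ℚP.*-identityʳ (G n)))
sumTo-*δ-∸ (suc d) zero    G = ℚP.*-zeroʳ (G 0)
sumTo-*δ-∸ (suc d) (suc n) G = begin
  sumTo n (λ a → G a * δ (suc d) (suc n ∸ a)) + G (suc n) * δ (suc d) (n ∸ n)
    ≡⟨ cong₂ _+_ (sumTo-cong n (λ a a≤n → cong (λ z → G a * δ (suc d) z) (ℕP.+-∸-assoc 1 a≤n)))
                 (trans (cong (λ z → G (suc n) * δ (suc d) z) (ℕP.n∸n≡0 n)) (ℚP.*-zeroʳ (G (suc n)))) ⟩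
  sumTo n (λ a → G a * δ d (n ∸ a)) + 0ℚ
    ≡⟨ ℚP.+-identityʳ _ ⟩
  sumTo n (λ a → G a * δ d (n ∸ a))
    ≡⟨ sumTo-*δ-∸ d n G ⟩
  shift d G n
    ∎
  where open ≡-Reasoning

infix 4 _≗₃_
_≗₃_ : Series3 → Series3 → Set
F ≗₃ G = ∀ i j k → F i j k ≡ G i j k

mono : ℕ → ℕ → ℕ → Series3
mono d e f p q r = δ d p * δ e q * δ f r

0*a*b≡0 : ∀ a b → 0ℚ * a * b ≡ 0ℚ
0*a*b≡0 a b = trans (cong (_* b) (ℚP.*-zeroˡ a)) (ℚP.*-zeroˡ b)

X≗mono : X ≗₃ mono 1 0 0
X≗mono zero          q       r       = sym (0*a*b≡0 (δ 0 q) (δ 0 r))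
X≗mono (suc (suc p)) q       r       = sym (0*a*b≡0 (δ 0 q) (δ 0 r))
X≗mono 1             zero    zero    = refl
X≗mono 1             zero    (suc r) = refl
X≗mono 1             (suc q) zero    = refl
X≗mono 1             (suc q) (suc r) = refl

Y≗mono : Y ≗₃ mono 0 1 0
Y≗mono (suc p) q             r       = sym (0*a*b≡0 (δ 1 q) (δ 0 r))
Y≗mono zero    zero          r       = sym (ℚP.*-zeroˡ (δ 0 r))
Y≗mono zero    (suc (suc q)) r       = sym (ℚP.*-zeroˡ (δ 0 r))
Y≗mono zero    1             zero    = refl
Y≗mono zero    1             (suc r) = refl

Z≗mono : Z ≗₃ mono 0 0 1
Z≗mono (suc p) q       r             = sym (0*a*b≡0 (δ 0 q) (δ 1 r))
Z≗mono zero    (suc q) r             = sym (ℚP.*-zeroˡ (δ 1 r))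
Z≗mono zero    zero    zero          = refl
Z≗mono zero    zero    1             = refl
Z≗mono zero    zero    (suc (suc r)) = refl

sum3 : ℕ → ℕ → ℕ → Series3 → ℚ
sum3 i j k G = sumTo i (λ a → sumTo j (λ b → sumTo k (G a b)))

sum3-cong : ∀ i j k {G H : Series3} → G ≗₃ H → sum3 i j k G ≡ sum3 i j k H
sum3-cong i j k G≗H = sumTo-cong i (λ a _ → sumTo-cong j (λ b _ → sumTo-cong k (λ c _ → G≗H a b c)))

sum3-distrib-+ : ∀ i j k (G H : Series3) → sum3 i j k (G ⊕ H) ≡ sum3 i j k G + sum3 i j k H
sum3-distrib-+ i j k G H = trans
  (sumTo-cong i (λ a _ → trans (sumTo-cong j (λ b _ → sumTo-distrib-+ k (G a b) (H a b)))
                               (sumTo-distrib-+ j _ _)))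
  (sumTo-distrib-+ i _ _)

sum3-*ˡ : ∀ i j k c (G : Series3) → sum3 i j k (scale c G) ≡ c * sum3 i j k G
sum3-*ˡ i j k c G = trans
  (sumTo-cong i (λ a _ → trans (sumTo-cong j (λ b _ → sumTo-*ˡ k c (G a b))) (sumTo-*ˡ j c _)))
  (sumTo-*ˡ i c _)

⊗-congʳ : ∀ F {G H} → G ≗₃ H → F ⊗ G ≗₃ F ⊗ H
⊗-congʳ F G≗H i j k = sum3-cong i j k (λ a b c → cong (F a b c *_) (G≗H (i ∸ a) (j ∸ b) (k ∸ c)))

⊗-distribˡ-⊕ : ∀ F G H → F ⊗ (G ⊕ H) ≗₃ (F ⊗ G) ⊕ (F ⊗ H)
⊗-distribˡ-⊕ F G H i j k = trans
  (sum3-cong i j k (λ a b c → ℚP.*-distribˡ-+ (F a b c) (G (i ∸ a) (j ∸ b) (k ∸ c)) _))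
  (sum3-distrib-+ i j k _ _)

⊗-scaleʳ : ∀ F c G → F ⊗ scale c G ≗₃ scale c (F ⊗ G)
⊗-scaleʳ F c G i j k = trans
  (sum3-cong i j k (λ a b c′ → solve 3 (λ f c g → f :* (c :* g) := c :* (f :* g)) refl
     (F a b c′) c (G (i ∸ a) (j ∸ b) (k ∸ c′))))
  (sum3-*ˡ i j k c _)

⊗-mono : ∀ F d e f i j k →
  (F ⊗ mono d e f) i j k ≡ shift d (λ a → shift e (λ b → shift f (F a b) k) j) i
⊗-mono F d e f i j k = begin
  sum3 i j k (λ a b c → F a b c * (δᵢ a * δⱼ b * δ f (k ∸ c)))
    ≡⟨ sumTo-cong i (λ a _ → sumTo-cong j (λ b _ → trans
         (sumTo-cong k (λ c _ → solve 4 (λ x y z w → x :* (y :* z :* w) := y :* z :* (x :* w)) refl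
            (F a b c) (δᵢ a) (δⱼ b) (δ f (k ∸ c))))
         (trans (sumTo-*ˡ k (δᵢ a * δⱼ b) _) (cong (δᵢ a * δⱼ b *_) (sumTo-*δ-∸ f k (F a b)))))) ⟩
  sumTo i (λ a → sumTo j (λ b → δᵢ a * δⱼ b * W a b))
    ≡⟨ sumTo-cong i (λ a _ → trans
         (sumTo-cong j (λ b _ → solve 3 (λ x y w → x :* y :* w := x :* (w :* y)) refl (δᵢ a) (δⱼ b) (W a b)))
         (trans (sumTo-*ˡ j (δᵢ a) _) (cong (δᵢ a *_) (sumTo-*δ-∸ e j (W a))))) ⟩
  sumTo i (λ a → δᵢ a * V a)
    ≡⟨ trans (sumTo-cong i (λ a _ → ℚP.*-comm (δᵢ a) (V a))) (sumTo-*δ-∸ d i V) ⟩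
  shift d V i
    ∎
  where
  open ≡-Reasoning
  δᵢ = λ a → δ d (i ∸ a)
  δⱼ = λ b → δ e (j ∸ b)
  W = λ a b → shift f (F a b) k
  V = λ a → shift e (W a) j

lin : ℚ → ℚ → ℚ → Series3
lin α β γ = (scale α X ⊕ scale β Y) ⊕ scale γ Z

⊗-lin : ∀ F α β γ i j k → (F ⊗ lin α β γ) i j k ≡
  α * shift 1 (λ a → F a j k) i + β * shift 1 (λ b → F i b k) j + γ * shift 1 (F i j) k
⊗-lin F α β γ i j k = begin
  (F ⊗ lin α β γ) i j k
    ≡⟨ trans (⊗-distribˡ-⊕ F (scale α X ⊕ scale β Y) (scale γ Z) i j k)
             (cong (_+ (F ⊗ scale γ Z) i j k) (⊗-distribˡ-⊕ F (scale α X) (scale β Y) i j k)) ⟩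
  (F ⊗ scale α X) i j k + (F ⊗ scale β Y) i j k + (F ⊗ scale γ Z) i j k
    ≡⟨ cong₂ _+_ (cong₂ _+_ (⊗-scaleʳ F α X i j k) (⊗-scaleʳ F β Y i j k)) (⊗-scaleʳ F γ Z i j k) ⟩
  α * (F ⊗ X) i j k + β * (F ⊗ Y) i j k + γ * (F ⊗ Z) i j k
    ≡⟨ cong₂ _+_ (cong₂ _+_ (cong (α *_) (trans (⊗-congʳ F X≗mono i j k) (⊗-mono F 1 0 0 i j k)))
                            (cong (β *_) (trans (⊗-congʳ F Y≗mono i j k) (⊗-mono F 0 1 0 i j k))))
                 (cong (γ *_) (trans (⊗-congʳ F Z≗mono i j k) (⊗-mono F 0 0 1 i j k))) ⟩
  α * shift 1 (λ a → F a j k) i + β * shift 1 (λ b → F i b k) j + γ * shift 1 (F i j) k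
    ∎
  where open ≡-Reasoning

-- Powers of a linear form: the multinomial and binomial theorems

powQ/fact : ℚ → ℕ → ℚ
powQ/fact c n = powQ c n * fact⁻¹ n

powQ/fact-suc : ∀ c n → ι (suc n) * powQ/fact c (suc n) ≡ c * powQ/fact c n
powQ/fact-suc c n = begin
  ι (suc n) * (powQ c n * c * fact⁻¹ (suc n))
    ≡⟨ solve 4 (λ i p c f → i :* (p :* c :* f) := c :* (p :* (f :* i))) refl (ι (suc n)) (powQ c n) c (fact⁻¹ (suc n)) ⟩
  c * (powQ c n * (fact⁻¹ (suc n) * ι (suc n)))
    ≡⟨ cong (λ z → c * (powQ c n * z)) (fact⁻¹-suc n) ⟩
  c * powQ/fact c n
    ∎
  where open ≡-Reasoning

expCoeff : ℚ → ℚ → ℚ → Series3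
expCoeff α β γ i j k = powQ/fact α i * powQ/fact β j * powQ/fact γ k

expCoeff-sucˣ : ∀ α β γ i j k → ι (suc i) * expCoeff α β γ (suc i) j k ≡ α * expCoeff α β γ i j k
expCoeff-sucˣ α β γ i j k = begin
  ι (suc i) * (powQ/fact α (suc i) * B * C)  ≡⟨ solve 4 (λ n x y z → n :* (x :* y :* z) := n :* x :* y :* z) refl (ι (suc i)) _ B C ⟩
  ι (suc i) * powQ/fact α (suc i) * B * C    ≡⟨ cong (λ w → w * B * C) (powQ/fact-suc α i) ⟩
  α * powQ/fact α i * B * C                  ≡⟨ solve 4 (λ c x y z → c :* x :* y :* z := c :* (x :* y :* z)) refl α _ B C ⟩
  α * (powQ/fact α i * B * C)                ∎
  where
  open ≡-Reasoning
  B = powQ/fact β j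
  C = powQ/fact γ k

expCoeff-sucʸ : ∀ α β γ i j k → ι (suc j) * expCoeff α β γ i (suc j) k ≡ β * expCoeff α β γ i j k
expCoeff-sucʸ α β γ i j k = begin
  ι (suc j) * (A * powQ/fact β (suc j) * C)  ≡⟨ solve 4 (λ n x y z → n :* (x :* y :* z) := x :* (n :* y) :* z) refl (ι (suc j)) A _ C ⟩
  A * (ι (suc j) * powQ/fact β (suc j)) * C  ≡⟨ cong (λ w → A * w * C) (powQ/fact-suc β j) ⟩
  A * (β * powQ/fact β j) * C                ≡⟨ solve 4 (λ c x y z → x :* (c :* y) :* z := c :* (x :* y :* z)) refl β A _ C ⟩
  β * (A * powQ/fact β j * C)                ∎
  where
  open ≡-Reasoning
  A = powQ/fact α i
  C = powQ/fact γ k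

expCoeff-sucᶻ : ∀ α β γ i j k → ι (suc k) * expCoeff α β γ i j (suc k) ≡ γ * expCoeff α β γ i j k
expCoeff-sucᶻ α β γ i j k = begin
  ι (suc k) * (A * B * powQ/fact γ (suc k))  ≡⟨ solve 4 (λ n x y z → n :* (x :* y :* z) := x :* y :* (n :* z)) refl (ι (suc k)) A B _ ⟩
  A * B * (ι (suc k) * powQ/fact γ (suc k))  ≡⟨ cong (A * B *_) (powQ/fact-suc γ k) ⟩
  A * B * (γ * powQ/fact γ k)                ≡⟨ solve 4 (λ c x y z → x :* y :* (c :* z) := c :* (x :* y :* z)) refl γ A B _ ⟩
  γ * (A * B * powQ/fact γ k)                ∎
  where
  open ≡-Reasoning
  A = powQ/fact α i
  B = powQ/fact β j

*-shift-δ : ∀ α c n (g : ℕ → ℕ) (E : ℕ → ℚ) →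
  (∀ b → g (suc b) ≡ suc (g b)) → (∀ b → ι (suc b) * E (suc b) ≡ α * E b) →
  ∀ x → α * shift 1 (λ b → δ n (g b) * (c * E b)) x ≡ δ (suc n) (g x) * (c * (ι x * E x))
*-shift-δ α c n g E g-suc E-suc zero = begin
  α * 0ℚ
    ≡⟨ ℚP.*-zeroʳ α ⟩
  0ℚ
    ≡⟨ solve 3 (λ d c e → con 0ℚ := d :* (c :* (con 0ℚ :* e))) refl (δ (suc n) (g 0)) c (E 0) ⟩
  δ (suc n) (g 0) * (c * (0ℚ * E 0))
    ∎
  where open ≡-Reasoning
*-shift-δ α c n g E g-suc E-suc (suc x) = begin
  α * (δ n (g x) * (c * E x))
    ≡⟨ solve 4 (λ a d c e → a :* (d :* (c :* e)) := d :* (c :* (a :* e))) refl α (δ n (g x)) c (E x) ⟩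
  δ (suc n) (suc (g x)) * (c * (α * E x))
    ≡⟨ cong₂ (λ d e → δ (suc n) d * (c * e)) (sym (g-suc x)) (sym (E-suc x)) ⟩
  δ (suc n) (g (suc x)) * (c * (ι (suc x) * E (suc x)))
    ∎
  where open ≡-Reasoning

pow3-linear : ∀ {L} α β γ → L ≗₃ lin α β γ → ∀ n →
  pow3 L n ≗₃ λ i j k → δ n (i ℕ.+ j ℕ.+ k) * (fact n * expCoeff α β γ i j k)
pow3-linear α β γ L≗lin zero    zero    zero    zero    = refl
pow3-linear α β γ L≗lin zero    zero    zero    (suc k) = sym (ℚP.*-zeroˡ (fact 0 * expCoeff α β γ 0 0 (suc k)))
pow3-linear α β γ L≗lin zero    zero    (suc j) k       = sym (ℚP.*-zeroˡ (fact 0 * expCoeff α β γ 0 (suc j) k))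
pow3-linear α β γ L≗lin zero    (suc i) j       k       = sym (ℚP.*-zeroˡ (fact 0 * expCoeff α β γ (suc i) j k))
pow3-linear {L} α β γ L≗lin (suc n) i j k = begin
  (pow3 L n ⊗ L) i j k
    ≡⟨ trans (⊗-congʳ (pow3 L n) L≗lin i j k) (⊗-lin (pow3 L n) α β γ i j k) ⟩
  α * shift 1 (λ a → pow3 L n a j k) i + β * shift 1 (λ b → pow3 L n i b k) j
    + γ * shift 1 (pow3 L n i j) k
    ≡⟨ cong₂ _+_ (cong₂ _+_ (cong (α *_) (shift-cong 1 i (λ a → IH a j k)))
                            (cong (β *_) (shift-cong 1 j (λ b → IH i b k))))
                 (cong (γ *_) (shift-cong 1 k (λ c → IH i j c))) ⟩
  α * shift 1 (λ a → δ n (a ℕ.+ j ℕ.+ k) * (fact n * E a j k)) i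
    + β * shift 1 (λ b → δ n (i ℕ.+ b ℕ.+ k) * (fact n * E i b k)) j
    + γ * shift 1 (λ c → δ n (i ℕ.+ j ℕ.+ c) * (fact n * E i j c)) k
    ≡⟨ cong₂ _+_ (cong₂ _+_
         (*-shift-δ α (fact n) n (λ a → a ℕ.+ j ℕ.+ k) (λ a → E a j k) (λ _ → refl)
            (λ a → expCoeff-sucˣ α β γ a j k) i)
         (*-shift-δ β (fact n) n (λ b → i ℕ.+ b ℕ.+ k) (λ b → E i b k) (λ b → cong (ℕ._+ k) (ℕP.+-suc i b))
            (λ b → expCoeff-sucʸ α β γ i b k) j))
         (*-shift-δ γ (fact n) n (λ c → i ℕ.+ j ℕ.+ c) (E i j) (ℕP.+-suc (i ℕ.+ j))
            (expCoeff-sucᶻ α β γ i j) k) ⟩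
  δ (suc n) N * (fact n * (ι i * E i j k)) + δ (suc n) N * (fact n * (ι j * E i j k))
    + δ (suc n) N * (fact n * (ι k * E i j k))
    ≡⟨ solve 6 (λ d f a b c e → d :* (f :* (a :* e)) :+ d :* (f :* (b :* e)) :+ d :* (f :* (c :* e))
                             := d :* (f :* ((a :+ b :+ c) :* e))) refl
         (δ (suc n) N) (fact n) (ι i) (ι j) (ι k) (E i j k) ⟩
  δ (suc n) N * (fact n * ((ι i + ι j + ι k) * E i j k))
    ≡⟨ cong (λ z → δ (suc n) N * (fact n * (z * E i j k))) (sym (trans (ι-+ (i ℕ.+ j) k) (cong (_+ ι k) (ι-+ i j)))) ⟩
  δ (suc n) N * (fact n * (ι N * E i j k))
    ≡⟨ δ-*-subst (suc n) N (λ z → fact n * (ι z * E i j k)) ⟩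
  δ (suc n) N * (fact n * (ι (suc n) * E i j k))
    ≡⟨ cong (δ (suc n) N *_) (sym (ℚP.*-assoc (fact n) (ι (suc n)) (E i j k))) ⟩
  δ (suc n) N * (fact (suc n) * E i j k)
    ∎
  where
  open ≡-Reasoning
  E = expCoeff α β γ
  N = i ℕ.+ j ℕ.+ k
  IH = pow3-linear α β γ L≗lin n

binomQ*fact≡falling : ∀ a n → binomQ a n * fact n ≡ falling a n
binomQ*fact≡falling a n = p÷'q*q≡p (falling a n) (fact n) (fact≢0 n)

onePlusPow-linear : ∀ {L} α β γ → L ≗₃ lin α β γ → ∀ a →
  onePlusPow L a ≗₃ λ i j k → falling a (i ℕ.+ j ℕ.+ k) * expCoeff α β γ i j k
onePlusPow-linear {L} α β γ L≗lin a i j k = begin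
  sumTo N (λ n → binomQ a n * pow3 L n i j k)
    ≡⟨ sumTo-cong N (λ n _ → trans (cong (binomQ a n *_) (pow3-linear α β γ L≗lin n i j k))
         (solve 4 (λ b d f e → b :* (d :* (f :* e)) := d :* (b :* f :* e)) refl (binomQ a n) (δ n N) (fact n) E)) ⟩
  sumTo N (λ n → δ n N * (binomQ a n * fact n * E))
    ≡⟨ sumTo-δ N (λ n → binomQ a n * fact n * E) ⟩
  binomQ a N * fact N * E
    ≡⟨ cong (_* E) (binomQ*fact≡falling a N) ⟩
  falling a N * E
    ∎
  where
  open ≡-Reasoning
  N = i ℕ.+ j ℕ.+ k
  E = expCoeff α β γ i j k

powQ/fact-neg : ∀ c n → powQ/fact (- c) n ≡ powQ (- 1ℚ) n * powQ/fact c n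
powQ/fact-neg c n = begin
  powQ (- c) n * fact⁻¹ n                   ≡⟨ cong (λ z → powQ z n * fact⁻¹ n) (solve 1 (λ c → :- c := con (- 1ℚ) :* c) refl c) ⟩
  powQ (- 1ℚ * c) n * fact⁻¹ n              ≡⟨ cong (_* fact⁻¹ n) (powQ-* (- 1ℚ) c n) ⟩
  powQ (- 1ℚ) n * powQ c n * fact⁻¹ n       ≡⟨ ℚP.*-assoc (powQ (- 1ℚ) n) (powQ c n) (fact⁻¹ n) ⟩
  powQ (- 1ℚ) n * powQ/fact c n             ∎
  where open ≡-Reasoning

onePlusPow-neg : ∀ {L} β γ → L ≗₃ lin (- 1ℚ) (- β) (- γ) → ∀ a →
  onePlusPow L a ≗₃ λ i j k → poch (- a) (i ℕ.+ j ℕ.+ k) * expCoeff 1ℚ β γ i j k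
onePlusPow-neg β γ L≗lin a i j k = begin
  onePlusPow _ a i j k
    ≡⟨ onePlusPow-linear (- 1ℚ) (- β) (- γ) L≗lin a i j k ⟩
  falling a N * (powQ/fact (- 1ℚ) i * powQ/fact (- β) j * powQ/fact (- γ) k)
    ≡⟨ cong (falling a N *_) (cong₂ _*_ (cong₂ _*_ (powQ/fact-neg 1ℚ i) (powQ/fact-neg β j)) (powQ/fact-neg γ k)) ⟩
  falling a N * (s i * powQ/fact 1ℚ i * (s j * powQ/fact β j) * (s k * powQ/fact γ k))
    ≡⟨ solve 7 (λ F a b c x y z → F :* (a :* x :* (b :* y) :* (c :* z)) := F :* (a :* b :* c) :* (x :* y :* z)) refl
         (falling a N) (s i) (s j) (s k) (powQ/fact 1ℚ i) (powQ/fact β j) (powQ/fact γ k) ⟩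
  falling a N * (s i * s j * s k) * expCoeff 1ℚ β γ i j k
    ≡⟨ cong (λ z → falling a N * z * expCoeff 1ℚ β γ i j k)
         (sym (trans (powQ-+ (- 1ℚ) (i ℕ.+ j) k) (cong (_* s k) (powQ-+ (- 1ℚ) i j)))) ⟩
  falling a N * s N * expCoeff 1ℚ β γ i j k
    ≡⟨ cong (_* expCoeff 1ℚ β γ i j k) (falling*[-1]^n≡poch a N) ⟩
  poch (- a) N * expCoeff 1ℚ β γ i j k
    ∎
  where
  open ≡-Reasoning
  N = i ℕ.+ j ℕ.+ k
  s = powQ (- 1ℚ)

powQ/fact-0-suc : ∀ n → powQ/fact 0ℚ (suc n) ≡ 0ℚ
powQ/fact-0-suc n = solve 2 (λ p f → p :* con 0ℚ :* f := con 0ℚ) refl (powQ 0ℚ n) (fact⁻¹ (suc n))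

powQ/fact-1 : ∀ n → powQ/fact 1ℚ n ≡ fact⁻¹ n
powQ/fact-1 n = trans (cong (_* fact⁻¹ n) (powQ-1 n)) (ℚP.*-identityˡ (fact⁻¹ n))

onePlusPow-y-free : ∀ {L} α γ → L ≗₃ lin α 0ℚ γ → ∀ a i j k → onePlusPow L a i (suc j) k ≡ 0ℚ
onePlusPow-y-free α γ L≗lin a i j k = trans (onePlusPow-linear α 0ℚ γ L≗lin a i (suc j) k)
  (trans (cong (λ z → falling a (i ℕ.+ suc j ℕ.+ k) * (powQ/fact α i * z * powQ/fact γ k)) (powQ/fact-0-suc j))
         (solve 3 (λ F x z → F :* (x :* con 0ℚ :* z) := con 0ℚ) refl (falling a (i ℕ.+ suc j ℕ.+ k)) (powQ/fact α i) (powQ/fact γ k)))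

onePlusPow-z-free : ∀ {L} α β → L ≗₃ lin α β 0ℚ → ∀ a i j k → onePlusPow L a i j (suc k) ≡ 0ℚ
onePlusPow-z-free α β L≗lin a i j k = trans (onePlusPow-linear α β 0ℚ L≗lin a i j (suc k))
  (trans (cong (λ z → falling a (i ℕ.+ j ℕ.+ suc k) * (powQ/fact α i * powQ/fact β j * z)) (powQ/fact-0-suc k))
         (solve 3 (λ F x y → F :* (x :* y :* con 0ℚ) := con 0ℚ) refl (falling a (i ℕ.+ j ℕ.+ suc k)) (powQ/fact α i) (powQ/fact β j)))

⊗-z-freeˡ : ∀ F G → (∀ a b c → F a b (suc c) ≡ 0ℚ) → ∀ i j k →
  (F ⊗ G) i j k ≡ sumTo i (λ a → sumTo j (λ b → F a b 0 * G (i ∸ a) (j ∸ b) k))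
⊗-z-freeˡ F G z-free i j k = sumTo-cong i (λ a _ → sumTo-cong j (λ b _ →
  sumTo≡head k (λ c → F a b c * G (i ∸ a) (j ∸ b) (k ∸ c))
    (λ c → trans (cong (_* G (i ∸ a) (j ∸ b) (k ∸ suc c)) (z-free a b c)) (ℚP.*-zeroˡ (G (i ∸ a) (j ∸ b) (k ∸ suc c))))))

⊗-yz-freeˡ : ∀ F G → (∀ a b c → F a (suc b) c ≡ 0ℚ) → (∀ a b c → F a b (suc c) ≡ 0ℚ) → ∀ i j k →
  (F ⊗ G) i j k ≡ sumTo i (λ a → F a 0 0 * G (i ∸ a) j k)
⊗-yz-freeˡ F G y-free z-free i j k = trans (⊗-z-freeˡ F G z-free i j k) (sumTo-cong i (λ a _ →
  sumTo≡head j (λ b → F a b 0 * G (i ∸ a) (j ∸ b) k)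
    (λ b → trans (cong (_* G (i ∸ a) (j ∸ suc b) k) (y-free a b 0)) (ℚP.*-zeroˡ (G (i ∸ a) (j ∸ suc b) k)))))

-- The diagonal

diagSum : ℚ → ℚ → ℚ → ℕ → ℚ
diagSum s t β m = antidiagonal m (λ b e → poch s b * powQ/fact β b * (poch t (e ℕ.+ m) * fact⁻¹ e))

inner-vandermonde : ∀ s t β p m →
  antidiagonal p (λ a q → antidiagonal m (λ b e →
      poch s (a ℕ.+ b) * (fact⁻¹ a * powQ/fact β b) * (poch t (q ℕ.+ e ℕ.+ m) * (fact⁻¹ q * fact⁻¹ e * fact⁻¹ m))))
    ≡ diagSum s t β m * fact⁻¹ m * poch/fact (s + t + ι (m ℕ.+ m)) p
inner-vandermonde s t β p m = begin
  antidiagonal p (λ a q → antidiagonal m (λ b e → term a q b e))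
    ≡⟨ antidiagonal-comm p m term ⟩
  antidiagonal m (λ b e → antidiagonal p (λ a q → term a q b e))
    ≡⟨ antidiagonal-cong m inner-sum ⟩
  antidiagonal m (λ b e → K b e * poch/fact (s + ι b + (t + ι (e ℕ.+ m))) p)
    ≡⟨ antidiagonal-cong m (λ b e → cong (λ z → K b e * poch/fact z p) (parameter b e)) ⟩
  antidiagonal m (λ b e → K b e * poch/fact (s + t + ι (b ℕ.+ e ℕ.+ m)) p)
    ≡⟨ antidiagonal-index-sum m (λ b e n → K b e * poch/fact (s + t + ι (n ℕ.+ m)) p) ⟩
  antidiagonal m (λ b e → K b e * poch/fact (s + t + ι (m ℕ.+ m)) p)
    ≡⟨ antidiagonal-*ʳ m (poch/fact (s + t + ι (m ℕ.+ m)) p) K ⟩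
  antidiagonal m K * poch/fact (s + t + ι (m ℕ.+ m)) p
    ≡⟨ cong (_* poch/fact (s + t + ι (m ℕ.+ m)) p) (antidiagonal-*ʳ m (fact⁻¹ m) summand) ⟩
  diagSum s t β m * fact⁻¹ m * poch/fact (s + t + ι (m ℕ.+ m)) p
    ∎
  where
  open ≡-Reasoning
  term : ℕ → ℕ → ℕ → ℕ → ℚ
  term a q b e = poch s (a ℕ.+ b) * (fact⁻¹ a * powQ/fact β b)
               * (poch t (q ℕ.+ e ℕ.+ m) * (fact⁻¹ q * fact⁻¹ e * fact⁻¹ m))
  summand : ℕ → ℕ → ℚ
  summand b e = poch s b * powQ/fact β b * (poch t (e ℕ.+ m) * fact⁻¹ e)
  K : ℕ → ℕ → ℚ
  K b e = summand b e * fact⁻¹ m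
  term-split : ∀ b e a q → term a q b e ≡ K b e * (poch/fact (s + ι b) a * poch/fact (t + ι (e ℕ.+ m)) q)
  term-split b e a q = begin
    term a q b e
      ≡⟨ cong₂ (λ x y → x * (fact⁻¹ a * powQ/fact β b) * (y * (fact⁻¹ q * fact⁻¹ e * fact⁻¹ m)))
           (trans (cong (poch s) (ℕP.+-comm a b)) (poch-+ s b a))
           (trans (cong (poch t) (trans (ℕP.+-assoc q e m) (ℕP.+-comm q (e ℕ.+ m)))) (poch-+ t (e ℕ.+ m) q)) ⟩
    poch s b * poch (s + ι b) a * (fact⁻¹ a * powQ/fact β b)
      * (poch t (e ℕ.+ m) * poch (t + ι (e ℕ.+ m)) q * (fact⁻¹ q * fact⁻¹ e * fact⁻¹ m))
      ≡⟨ solve 9 (λ Pb Pa Ia Wb Te Tq Iq Ie Im →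
            Pb :* Pa :* (Ia :* Wb) :* (Te :* Tq :* (Iq :* Ie :* Im))
            := Pb :* Wb :* (Te :* Ie) :* Im :* (Pa :* Ia :* (Tq :* Iq))) refl
           (poch s b) (poch (s + ι b) a) (fact⁻¹ a) (powQ/fact β b) (poch t (e ℕ.+ m)) (poch (t + ι (e ℕ.+ m)) q)
           (fact⁻¹ q) (fact⁻¹ e) (fact⁻¹ m) ⟩
    K b e * (poch/fact (s + ι b) a * poch/fact (t + ι (e ℕ.+ m)) q)
      ∎
  inner-sum : ∀ b e → antidiagonal p (λ a q → term a q b e) ≡ K b e * poch/fact (s + ι b + (t + ι (e ℕ.+ m))) p
  inner-sum b e = begin
    antidiagonal p (λ a q → term a q b e)
      ≡⟨ antidiagonal-cong p (term-split b e) ⟩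
    antidiagonal p (λ a q → K b e * (poch/fact (s + ι b) a * poch/fact (t + ι (e ℕ.+ m)) q))
      ≡⟨ antidiagonal-*ˡ p (K b e) (λ a q → poch/fact (s + ι b) a * poch/fact (t + ι (e ℕ.+ m)) q) ⟩
    K b e * antidiagonal p (λ a q → poch/fact (s + ι b) a * poch/fact (t + ι (e ℕ.+ m)) q)
      ≡⟨ cong (K b e *_) (chu-vandermonde (s + ι b) (t + ι (e ℕ.+ m)) p) ⟩
    K b e * poch/fact (s + ι b + (t + ι (e ℕ.+ m))) p
      ∎
  parameter : ∀ b e → s + ι b + (t + ι (e ℕ.+ m)) ≡ s + t + ι (b ℕ.+ e ℕ.+ m)
  parameter b e = begin
    s + ι b + (t + ι (e ℕ.+ m))   ≡⟨ solve 3 (λ s b t → s :+ b :+ t := s :+ t :+ b) refl s (ι b) (t + ι (e ℕ.+ m)) ⟩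
    s + (t + ι (e ℕ.+ m)) + ι b   ≡⟨ solve 4 (λ s t x y → s :+ (t :+ x) :+ y := s :+ t :+ (y :+ x)) refl s t (ι (e ℕ.+ m)) (ι b) ⟩
    s + t + (ι b + ι (e ℕ.+ m))   ≡⟨ cong (λ z → s + t + z) (sym (ι-+ b (e ℕ.+ m))) ⟩
    s + t + ι (b ℕ.+ (e ℕ.+ m))   ≡⟨ cong (λ n → s + t + ι n) (sym (ℕP.+-assoc b e m)) ⟩
    s + t + ι (b ℕ.+ e ℕ.+ m)     ∎

diagonal-coefficient : ∀ {L₁ L₂ L₃} β R S T →
  L₁ ≗₃ lin (- 1ℚ) 0ℚ 0ℚ → L₂ ≗₃ lin (- 1ℚ) (- β) 0ℚ → L₃ ≗₃ lin (- 1ℚ) (- 1ℚ) (- 1ℚ) → ∀ m →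
  Diag (onePlusPow L₁ R ⊗ (onePlusPow L₂ S ⊗ onePlusPow L₃ T)) m
    ≡ diagSum (- S) (- T) β m * fact⁻¹ m * poch/fact (- R + (- S + - T + ι (m ℕ.+ m))) m
diagonal-coefficient {L₁} {L₂} {L₃} β R S T L₁≗ L₂≗ L₃≗ m = begin
  (A ⊗ (B ⊗ C)) m m m
    ≡⟨ ⊗-yz-freeˡ A (B ⊗ C) (λ a b c → onePlusPow-y-free (- 1ℚ) 0ℚ L₁≗ R a b c)
                            (λ a b c → onePlusPow-z-free (- 1ℚ) 0ℚ L₁≗ R a b c) m m m ⟩
  antidiagonal m (λ a p → A a 0 0 * (B ⊗ C) p m m)
    ≡⟨ antidiagonal-cong m (λ a p → cong₂ _*_ (A-coeff a)
         (trans (⊗-z-freeˡ B C (λ a b c → onePlusPow-z-free (- 1ℚ) (- β) L₂≗ S a b c) p m m)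
                (antidiagonal-cong p (λ a q → antidiagonal-cong m (λ b e → cong₂ _*_ (B-coeff a b) (C-coeff q e m)))))) ⟩
  antidiagonal m (λ a p → poch/fact r a * antidiagonal p (λ a q → antidiagonal m (λ b e →
      poch s (a ℕ.+ b) * (fact⁻¹ a * powQ/fact β b) * (poch t (q ℕ.+ e ℕ.+ m) * (fact⁻¹ q * fact⁻¹ e * fact⁻¹ m)))))
    ≡⟨ antidiagonal-cong m (λ a p → cong (poch/fact r a *_) (inner-vandermonde s t β p m)) ⟩
  antidiagonal m (λ a p → poch/fact r a * (κ * poch/fact w p))
    ≡⟨ antidiagonal-cong m (λ a p → solve 3 (λ x k y → x :* (k :* y) := k :* (x :* y)) refl (poch/fact r a) κ (poch/fact w p)) ⟩
  antidiagonal m (λ a p → κ * (poch/fact r a * poch/fact w p))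
    ≡⟨ trans (antidiagonal-*ˡ m κ (λ a p → poch/fact r a * poch/fact w p)) (cong (κ *_) (chu-vandermonde r w m)) ⟩
  κ * poch/fact (r + w) m
    ∎
  where
  open ≡-Reasoning
  A = onePlusPow L₁ R
  B = onePlusPow L₂ S
  C = onePlusPow L₃ T
  r = - R
  s = - S
  t = - T
  w = s + t + ι (m ℕ.+ m)
  κ = diagSum s t β m * fact⁻¹ m
  A-coeff : ∀ a → A a 0 0 ≡ poch/fact r a
  A-coeff a = begin
    A a 0 0                                      ≡⟨ onePlusPow-neg 0ℚ 0ℚ L₁≗ R a 0 0 ⟩
    poch r (a ℕ.+ 0 ℕ.+ 0) * (powQ/fact 1ℚ a * 1ℚ * 1ℚ)
      ≡⟨ cong₂ (λ n x → poch r n * (x * 1ℚ * 1ℚ)) (trans (ℕP.+-identityʳ (a ℕ.+ 0)) (ℕP.+-identityʳ a)) (powQ/fact-1 a) ⟩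
    poch r a * (fact⁻¹ a * 1ℚ * 1ℚ)              ≡⟨ cong (poch r a *_) (solve 1 (λ x → x :* con 1ℚ :* con 1ℚ := x) refl (fact⁻¹ a)) ⟩
    poch/fact r a                                ∎
  B-coeff : ∀ a b → B a b 0 ≡ poch s (a ℕ.+ b) * (fact⁻¹ a * powQ/fact β b)
  B-coeff a b = begin
    B a b 0                                      ≡⟨ onePlusPow-neg β 0ℚ L₂≗ S a b 0 ⟩
    poch s (a ℕ.+ b ℕ.+ 0) * (powQ/fact 1ℚ a * powQ/fact β b * 1ℚ)
      ≡⟨ cong₂ (λ n x → poch s n * (x * powQ/fact β b * 1ℚ)) (ℕP.+-identityʳ (a ℕ.+ b)) (powQ/fact-1 a) ⟩
    poch s (a ℕ.+ b) * (fact⁻¹ a * powQ/fact β b * 1ℚ)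
      ≡⟨ cong (poch s (a ℕ.+ b) *_) (ℚP.*-identityʳ (fact⁻¹ a * powQ/fact β b)) ⟩
    poch s (a ℕ.+ b) * (fact⁻¹ a * powQ/fact β b) ∎
  C-coeff : ∀ a b c → C a b c ≡ poch t (a ℕ.+ b ℕ.+ c) * (fact⁻¹ a * fact⁻¹ b * fact⁻¹ c)
  C-coeff a b c = trans (onePlusPow-neg 1ℚ 1ℚ L₃≗ T a b c)
    (cong (poch t (a ℕ.+ b ℕ.+ c) *_) (cong₂ _*_ (cong₂ _*_ (powQ/fact-1 a) (powQ/fact-1 b)) (powQ/fact-1 c)))

diagSum-unit : ∀ s t m → diagSum s t 1ℚ m ≡ poch t m * poch/fact (s + (t + ι m)) m
diagSum-unit s t m = begin
  diagSum s t 1ℚ m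
    ≡⟨ antidiagonal-cong m (λ b e → begin
         poch s b * powQ/fact 1ℚ b * (poch t (e ℕ.+ m) * fact⁻¹ e)
           ≡⟨ cong₂ (λ x y → poch s b * x * (y * fact⁻¹ e)) (powQ/fact-1 b)
                (trans (cong (poch t) (ℕP.+-comm e m)) (poch-+ t m e)) ⟩
         poch s b * fact⁻¹ b * (poch t m * poch (t + ι m) e * fact⁻¹ e)
           ≡⟨ solve 5 (λ a b c d f → a :* b :* (c :* d :* f) := c :* (a :* b :* (d :* f))) refl
                (poch s b) (fact⁻¹ b) (poch t m) (poch (t + ι m) e) (fact⁻¹ e) ⟩
         poch t m * (poch/fact s b * poch/fact (t + ι m) e)
           ∎) ⟩
  antidiagonal m (λ b e → poch t m * (poch/fact s b * poch/fact (t + ι m) e))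
    ≡⟨ antidiagonal-*ˡ m (poch t m) (λ b e → poch/fact s b * poch/fact (t + ι m) e) ⟩
  poch t m * antidiagonal m (λ b e → poch/fact s b * poch/fact (t + ι m) e)
    ≡⟨ cong (poch t m *_) (chu-vandermonde s (t + ι m) m) ⟩
  poch t m * poch/fact (s + (t + ι m)) m
    ∎
  where open ≡-Reasoning

-- A WZ pair

wzTerm : ℚ → ℕ → ℕ → ℚ
wzTerm s b e = poch s b * powQ (+ 2 / 1) b * fact⁻¹ b * (fact (b ℕ.+ e ℕ.+ e) * fact⁻¹ e)

-- The certificate is − b/(b + 2e) · wzTerm s b e, as produced by Zeilberger's algorithm.
wzCert : ℚ → ℕ → ℕ → ℚ
wzCert s zero    e = 0ℚ
wzCert s (suc b) e = - (poch s (suc b) * powQ (+ 2 / 1) (suc b) * fact⁻¹ b * (fact (b ℕ.+ e ℕ.+ e) * fact⁻¹ e))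

ι[b+e+e] : ∀ b e → ι (b ℕ.+ e ℕ.+ e) ≡ ι b + ι e + ι e
ι[b+e+e] b e = trans (ι-+ (b ℕ.+ e) e) (cong (_+ ι e) (ι-+ b e))

b+[1+e]+[1+e] : ∀ b e → b ℕ.+ suc e ℕ.+ suc e ≡ suc (suc (b ℕ.+ e ℕ.+ e))
b+[1+e]+[1+e] b e = trans (cong (ℕ._+ suc e) (ℕP.+-suc b e)) (cong suc (ℕP.+-suc (b ℕ.+ e) e))

wzTerm-sucʳ : ∀ s b e → ι (suc e) * wzTerm s b (suc e) ≡
  poch s b * powQ (+ 2 / 1) b * fact⁻¹ b * fact (b ℕ.+ e ℕ.+ e)
    * (ι b + ι e + ι e + 1ℚ) * (ι b + ι e + ι e + 1ℚ + 1ℚ) * fact⁻¹ e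
wzTerm-sucʳ s b e = begin
  ι (suc e) * (P * (fact (b ℕ.+ suc e ℕ.+ suc e) * fact⁻¹ (suc e)))
    ≡⟨ cong (λ n → ι (suc e) * (P * (fact n * fact⁻¹ (suc e)))) (b+[1+e]+[1+e] b e) ⟩
  ι (suc e) * (P * (F * ι (suc n) * ι (suc (suc n)) * fact⁻¹ (suc e)))
    ≡⟨ solve 6 (λ ie P F a c Ise → ie :* (P :* (F :* a :* c :* Ise)) := P :* F :* a :* c :* (Ise :* ie)) refl
         (ι (suc e)) P F (ι (suc n)) (ι (suc (suc n))) (fact⁻¹ (suc e)) ⟩
  P * F * ι (suc n) * ι (suc (suc n)) * (fact⁻¹ (suc e) * ι (suc e))
    ≡⟨ cong₂ (λ x y → P * F * x * y * (fact⁻¹ (suc e) * ι (suc e))) ι[1+n] ι[2+n] ⟩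
  P * F * (ι b + ι e + ι e + 1ℚ) * (ι b + ι e + ι e + 1ℚ + 1ℚ) * (fact⁻¹ (suc e) * ι (suc e))
    ≡⟨ cong (P * F * (ι b + ι e + ι e + 1ℚ) * (ι b + ι e + ι e + 1ℚ + 1ℚ) *_) (fact⁻¹-suc e) ⟩
  P * F * (ι b + ι e + ι e + 1ℚ) * (ι b + ι e + ι e + 1ℚ + 1ℚ) * fact⁻¹ e
    ∎
  where
  open ≡-Reasoning
  n = b ℕ.+ e ℕ.+ e
  P = poch s b * powQ (+ 2 / 1) b * fact⁻¹ b
  F = fact n
  ι[1+n] : ι (suc n) ≡ ι b + ι e + ι e + 1ℚ
  ι[1+n] = trans (ι-suc n) (cong (_+ 1ℚ) (ι[b+e+e] b e))
  ι[2+n] : ι (suc (suc n)) ≡ ι b + ι e + ι e + 1ℚ + 1ℚ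
  ι[2+n] = trans (ι-suc (suc n)) (cong (_+ 1ℚ) ι[1+n])

wzCert-sucʳ : ∀ s b e → ι (suc e) * wzCert s b (suc e) ≡
  - (poch s b * powQ (+ 2 / 1) b * fact⁻¹ b * ι b * fact (b ℕ.+ e ℕ.+ e) * (ι b + ι e + ι e + 1ℚ) * fact⁻¹ e)
wzCert-sucʳ s zero    e = solve 4 (λ i F x y → i :* con 0ℚ := :- (con 1ℚ :* con 1ℚ :* con 1ℚ :* con 0ℚ :* F :* x :* y)) refl
  (ι (suc e)) (fact (e ℕ.+ e)) (ι 0 + ι e + ι e + 1ℚ) (fact⁻¹ e)
wzCert-sucʳ s (suc b) e = begin
  ι (suc e) * - (P * W * fact⁻¹ b * (fact (b ℕ.+ suc e ℕ.+ suc e) * fact⁻¹ (suc e)))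
    ≡⟨ cong₂ (λ x n → ι (suc e) * - (P * W * x * (fact n * fact⁻¹ (suc e)))) (sym (fact⁻¹-suc b)) (b+[1+e]+[1+e] b e) ⟩
  ι (suc e) * - (P * W * (fact⁻¹ (suc b) * ι (suc b)) * (F * ι (suc n) * fact⁻¹ (suc e)))
    ≡⟨ solve 8 (λ ie P W Ib ib F a Ise → ie :* :- (P :* W :* (Ib :* ib) :* (F :* a :* Ise))
                                      := :- (P :* W :* Ib :* ib :* F :* a :* (Ise :* ie))) refl
         (ι (suc e)) P W (fact⁻¹ (suc b)) (ι (suc b)) F (ι (suc n)) (fact⁻¹ (suc e)) ⟩
  - (P * W * fact⁻¹ (suc b) * ι (suc b) * F * ι (suc n) * (fact⁻¹ (suc e) * ι (suc e)))
    ≡⟨ cong₂ (λ x y → - (P * W * fact⁻¹ (suc b) * ι (suc b) * F * x * y))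
         (trans (ι-suc n) (cong (_+ 1ℚ) (ι[b+e+e] (suc b) e))) (fact⁻¹-suc e) ⟩
  - (P * W * fact⁻¹ (suc b) * ι (suc b) * F * (ι (suc b) + ι e + ι e + 1ℚ) * fact⁻¹ e)
    ∎
  where
  open ≡-Reasoning
  n = suc b ℕ.+ e ℕ.+ e
  P = poch s (suc b)
  W = powQ (+ 2 / 1) (suc b)
  F = fact n

wz-recurrence : ∀ s b e → wzTerm s b (suc e) ≡
  (+ 2 / 1) * (s + 1ℚ + (ι b + ι e) + (ι b + ι e)) * wzTerm s b e + (wzCert s (suc b) e - wzCert s b (suc e))
wz-recurrence s b e = *-cancelʳ-≢0 (ι (suc e)) (ι-suc≢0 e)
  (trans (ℚP.*-comm (wzTerm s b (suc e)) (ι (suc e))) (trans (wzTerm-sucʳ s b e) (sym (begin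
    (κ * wzTerm s b e + (wzCert s (suc b) e - wzCert s b (suc e))) * ι (suc e)
      ≡⟨ solve 5 (λ k f t₁ t₂ i → (k :* f :+ (t₁ :- t₂)) :* i := i :* k :* f :+ i :* t₁ :- i :* t₂) refl
           κ (wzTerm s b e) (wzCert s (suc b) e) (wzCert s b (suc e)) (ι (suc e)) ⟩
    ι (suc e) * κ * wzTerm s b e + ι (suc e) * wzCert s (suc b) e - ι (suc e) * wzCert s b (suc e)
      ≡⟨ cong₂ (λ x y → x * κ * wzTerm s b e + x * wzCert s (suc b) e - y) (ι-suc e) (wzCert-sucʳ s b e) ⟩
    (ι e + 1ℚ) * κ * wzTerm s b e + (ι e + 1ℚ) * wzCert s (suc b) e - - (P * W * Ib * ι b * F * (ι b + ι e + ι e + 1ℚ) * Ie)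
      ≡⟨ solve 8 (λ ie P W Ib F Ie s ib →
           (ie :+ con 1ℚ) :* (con (+ 2 / 1) :* (s :+ con 1ℚ :+ (ib :+ ie) :+ (ib :+ ie))) :* (P :* W :* Ib :* (F :* Ie))
           :+ (ie :+ con 1ℚ) :* (:- (P :* (s :+ ib) :* (W :* con (+ 2 / 1)) :* Ib :* (F :* Ie)))
           :- (:- (P :* W :* Ib :* ib :* F :* (ib :+ ie :+ ie :+ con 1ℚ) :* Ie))
           := P :* W :* Ib :* F :* (ib :+ ie :+ ie :+ con 1ℚ) :* (ib :+ ie :+ ie :+ con 1ℚ :+ con 1ℚ) :* Ie) refl
           (ι e) P W Ib F Ie s (ι b) ⟩
    P * W * Ib * F * (ι b + ι e + ι e + 1ℚ) * (ι b + ι e + ι e + 1ℚ + 1ℚ) * Ie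
      ∎))))
  where
  open ≡-Reasoning
  κ = (+ 2 / 1) * (s + 1ℚ + (ι b + ι e) + (ι b + ι e))
  P = poch s b
  W = powQ (+ 2 / 1) b
  Ib = fact⁻¹ b
  F = fact (b ℕ.+ e ℕ.+ e)
  Ie = fact⁻¹ e

wz-boundary : ∀ s m → wzCert s (suc m) 0 + wzTerm s (suc m) 0 ≡ 0ℚ
wz-boundary s m = begin
  - (P * fact⁻¹ m * (fact (m ℕ.+ 0 ℕ.+ 0) * 1ℚ)) + P * fact⁻¹ (suc m) * (fact (suc (m ℕ.+ 0 ℕ.+ 0)) * 1ℚ)
    ≡⟨ cong (λ n → - (P * fact⁻¹ m * (fact n * 1ℚ)) + P * fact⁻¹ (suc m) * (fact (suc n) * 1ℚ)) m+0+0≡m ⟩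
  - (P * fact⁻¹ m * (fact m * 1ℚ)) + P * fact⁻¹ (suc m) * (fact (suc m) * 1ℚ)
    ≡⟨ solve 5 (λ P I F J G → :- (P :* I :* (F :* con 1ℚ)) :+ P :* J :* (G :* con 1ℚ) := P :* (J :* G) :- P :* (I :* F)) refl
         P (fact⁻¹ m) (fact m) (fact⁻¹ (suc m)) (fact (suc m)) ⟩
  P * (fact⁻¹ (suc m) * fact (suc m)) - P * (fact⁻¹ m * fact m)
    ≡⟨ cong₂ (λ x y → P * x - P * y) (fact⁻¹*fact≡1 (suc m)) (fact⁻¹*fact≡1 m) ⟩
  P * 1ℚ - P * 1ℚ
    ≡⟨ solve 1 (λ P → P :* con 1ℚ :- P :* con 1ℚ := con 0ℚ) refl P ⟩
  0ℚ
    ∎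
  where
  open ≡-Reasoning
  P = poch s (suc m) * powQ (+ 2 / 1) (suc m)
  m+0+0≡m : m ℕ.+ 0 ℕ.+ 0 ≡ m
  m+0+0≡m = trans (ℕP.+-identityʳ (m ℕ.+ 0)) (ℕP.+-identityʳ m)

wzSum-suc : ∀ s m → antidiagonal (suc m) (wzTerm s) ≡ (+ 2 / 1) * (s + 1ℚ + ι m + ι m) * antidiagonal m (wzTerm s)
wzSum-suc s m = begin
  antidiagonal (suc m) (wzTerm s)
    ≡⟨ antidiagonal-suc-last m (wzTerm s) ⟩
  antidiagonal m (λ b e → wzTerm s b (suc e)) + wzTerm s (suc m) 0
    ≡⟨ cong (_+ wzTerm s (suc m) 0) (trans (antidiagonal-cong m (wz-recurrence s))
         (antidiagonal-distrib-+ m (λ b e → κ (ι b + ι e) * wzTerm s b e) (λ b e → wzCert s (suc b) e - wzCert s b (suc e)))) ⟩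
  antidiagonal m (λ b e → κ (ι b + ι e) * wzTerm s b e)
    + antidiagonal m (λ b e → wzCert s (suc b) e - wzCert s b (suc e)) + wzTerm s (suc m) 0
    ≡⟨ cong₂ (λ x y → x + y + wzTerm s (suc m) 0)
         (trans (antidiagonal-index-sumℚ m (λ b e x → κ x * wzTerm s b e)) (antidiagonal-*ˡ m (κ (ι m)) (wzTerm s)))
         telescope ⟩
  κ (ι m) * antidiagonal m (wzTerm s) + (wzCert s (suc m) 0 - 0ℚ) + wzTerm s (suc m) 0
    ≡⟨ solve 3 (λ a c f → a :+ (c :- con 0ℚ) :+ f := a :+ (c :+ f)) refl
         (κ (ι m) * antidiagonal m (wzTerm s)) (wzCert s (suc m) 0) (wzTerm s (suc m) 0) ⟩
  κ (ι m) * antidiagonal m (wzTerm s) + (wzCert s (suc m) 0 + wzTerm s (suc m) 0)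
    ≡⟨ cong (λ z → κ (ι m) * antidiagonal m (wzTerm s) + z) (wz-boundary s m) ⟩
  κ (ι m) * antidiagonal m (wzTerm s) + 0ℚ
    ≡⟨ ℚP.+-identityʳ (κ (ι m) * antidiagonal m (wzTerm s)) ⟩
  (+ 2 / 1) * (s + 1ℚ + ι m + ι m) * antidiagonal m (wzTerm s)
    ∎
  where
  open ≡-Reasoning
  κ : ℚ → ℚ
  κ x = (+ 2 / 1) * (s + 1ℚ + x + x)
  telescope : antidiagonal m (λ b e → wzCert s (suc b) e - wzCert s b (suc e)) ≡ wzCert s (suc m) 0 - 0ℚ
  telescope = begin
    antidiagonal m (λ b e → wzCert s (suc b) e - wzCert s b (suc e))
      ≡⟨ sumTo-cong m (λ b b≤m → cong (λ n → wzCert s (suc b) (m ∸ b) - wzCert s b n) (sym (ℕP.+-∸-assoc 1 b≤m))) ⟩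
    sumTo m (λ b → wzCert s (suc b) (suc m ∸ suc b) - wzCert s b (suc m ∸ b))
      ≡⟨ sumTo-telescope m (λ b → wzCert s b (suc m ∸ b)) ⟩
    wzCert s (suc m) (m ∸ m) - 0ℚ
      ≡⟨ cong (λ n → wzCert s (suc m) n - 0ℚ) (ℕP.n∸n≡0 m) ⟩
    wzCert s (suc m) 0 - 0ℚ
      ∎

wzSum : ∀ s h → (+ 2 / 1) * h ≡ s + 1ℚ → ∀ m → antidiagonal m (wzTerm s) ≡ powQ (+ 4 / 1) m * poch h m
wzSum s h 2h≡s+1 zero    = refl
wzSum s h 2h≡s+1 (suc m) = begin
  antidiagonal (suc m) (wzTerm s)
    ≡⟨ wzSum-suc s m ⟩
  (+ 2 / 1) * (s + 1ℚ + ι m + ι m) * antidiagonal m (wzTerm s)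
    ≡⟨ cong₂ (λ x y → (+ 2 / 1) * (x + ι m + ι m) * y) (sym 2h≡s+1) (wzSum s h 2h≡s+1 m) ⟩
  (+ 2 / 1) * ((+ 2 / 1) * h + ι m + ι m) * (powQ (+ 4 / 1) m * poch h m)
    ≡⟨ solve 4 (λ h i F P → con (+ 2 / 1) :* (con (+ 2 / 1) :* h :+ i :+ i) :* (F :* P) := F :* con (+ 4 / 1) :* (P :* (h :+ i)))
         refl h (ι m) (powQ (+ 4 / 1) m) (poch h m) ⟩
  powQ (+ 4 / 1) m * (+ 4 / 1) * (poch h m * (h + ι m))
    ∎
  where open ≡-Reasoning

diagSum-double : ∀ s h → (+ 2 / 1) * h ≡ s + 1ℚ → ∀ m → diagSum s 1ℚ (+ 2 / 1) m ≡ powQ (+ 4 / 1) m * poch h m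
diagSum-double s h 2h≡s+1 m = begin
  diagSum s 1ℚ (+ 2 / 1) m
    ≡⟨ antidiagonal-cong m (λ b e → cong (λ x → poch s b * powQ/fact (+ 2 / 1) b * (x * fact⁻¹ e)) (poch-1 (e ℕ.+ m))) ⟩
  antidiagonal m (λ b e → poch s b * powQ/fact (+ 2 / 1) b * (fact (e ℕ.+ m) * fact⁻¹ e))
    ≡⟨ sym (antidiagonal-index-sum m (λ b e n → poch s b * powQ/fact (+ 2 / 1) b * (fact (e ℕ.+ n) * fact⁻¹ e))) ⟩
  antidiagonal m (λ b e → poch s b * powQ/fact (+ 2 / 1) b * (fact (e ℕ.+ (b ℕ.+ e)) * fact⁻¹ e))
    ≡⟨ antidiagonal-cong m (λ b e → trans
         (cong (λ n → poch s b * powQ/fact (+ 2 / 1) b * (fact n * fact⁻¹ e)) (ℕP.+-comm e (b ℕ.+ e)))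
         (cong (_* (fact (b ℕ.+ e ℕ.+ e) * fact⁻¹ e)) (sym (ℚP.*-assoc (poch s b) (powQ (+ 2 / 1) b) (fact⁻¹ b))))) ⟩
  antidiagonal m (wzTerm s)
    ≡⟨ wzSum s h 2h≡s+1 m ⟩
  powQ (+ 4 / 1) m * poch h m
    ∎
  where open ≡-Reasoning

[-x]≗lin : zero3 ⊖ X ≗₃ lin (- 1ℚ) 0ℚ 0ℚ
[-x]≗lin i j k = solve 3 (λ x y z → con 0ℚ :- x := con (- 1ℚ) :* x :+ con 0ℚ :* y :+ con 0ℚ :* z) refl
  (X i j k) (Y i j k) (Z i j k)

[-x-y]≗lin : (zero3 ⊖ X) ⊖ Y ≗₃ lin (- 1ℚ) (- 1ℚ) 0ℚ
[-x-y]≗lin i j k = solve 3 (λ x y z → con 0ℚ :- x :- y := con (- 1ℚ) :* x :+ con (- 1ℚ) :* y :+ con 0ℚ :* z) refl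
  (X i j k) (Y i j k) (Z i j k)

[-x-βy]≗lin : ∀ β → (zero3 ⊖ X) ⊖ scale β Y ≗₃ lin (- 1ℚ) (- β) 0ℚ
[-x-βy]≗lin β i j k = solve 4 (λ b x y z → con 0ℚ :- x :- b :* y := con (- 1ℚ) :* x :+ (:- b) :* y :+ con 0ℚ :* z) refl
  β (X i j k) (Y i j k) (Z i j k)

[-x-y-z]≗lin : ((zero3 ⊖ X) ⊖ Y) ⊖ Z ≗₃ lin (- 1ℚ) (- 1ℚ) (- 1ℚ)
[-x-y-z]≗lin i j k = solve 3 (λ x y z → con 0ℚ :- x :- y :- z := con (- 1ℚ) :* x :+ con (- 1ℚ) :* y :+ con (- 1ℚ) :* z) refl
  (X i j k) (Y i j k) (Z i j k)

-- Recognising a hypergeometric coefficient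

prodL-poch≢0 : ∀ {bs} m → HypDefined bs → prodL (map (λ b → poch b m) bs) ≢ 0ℚ
prodL-poch≢0 m []                   ()
prodL-poch≢0 m (b+j≢0 ∷ bs-defined) = *-≢0 (poch≢0 _ m b+j≢0) (prodL-poch≢0 m bs-defined)

HypF-intro : ∀ as bs c m {x} → HypDefined bs →
  x * (prodL (map (λ b → poch b m) bs) * fact m) ≡ prodL (map (λ a → poch a m) as) * powQ c m →
  x ≡ HypF as bs c m
HypF-intro as bs c m defined = x*q≡p*c⇒x≡p÷'q*c _ _ (powQ c m) (*-≢0 (prodL-poch≢0 m defined) (fact≢0 m))

diagonal-closed-form₁ : ∀ R S T m →
  Diag (onePlusPow (zero3 ⊖ X) R ⊗ (onePlusPow ((zero3 ⊖ X) ⊖ Y) S ⊗ onePlusPow (((zero3 ⊖ X) ⊖ Y) ⊖ Z) T)) m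
    ≡ poch (- T) m * poch/fact (- (S + T) + ι m) m * fact⁻¹ m * poch/fact (- (R + S + T) + ι (m ℕ.+ m)) m
diagonal-closed-form₁ R S T m = begin
  Diag (onePlusPow (zero3 ⊖ X) R ⊗ (onePlusPow ((zero3 ⊖ X) ⊖ Y) S ⊗ onePlusPow (((zero3 ⊖ X) ⊖ Y) ⊖ Z) T)) m
    ≡⟨ diagonal-coefficient 1ℚ R S T [-x]≗lin [-x-y]≗lin [-x-y-z]≗lin m ⟩
  diagSum (- S) (- T) 1ℚ m * fact⁻¹ m * poch/fact (- R + (- S + - T + ι (m ℕ.+ m))) m
    ≡⟨ cong₂ (λ d w → d * fact⁻¹ m * poch/fact w m) (diagSum-unit (- S) (- T) m)
         (solve 4 (λ R S T i → :- R :+ (:- S :+ :- T :+ i) := :- (R :+ S :+ T) :+ i) refl R S T (ι (m ℕ.+ m))) ⟩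
  poch (- T) m * poch/fact (- S + (- T + ι m)) m * fact⁻¹ m * poch/fact (- (R + S + T) + ι (m ℕ.+ m)) m
    ≡⟨ cong (λ w → poch (- T) m * poch/fact w m * fact⁻¹ m * poch/fact (- (R + S + T) + ι (m ℕ.+ m)) m)
         (solve 3 (λ S T i → :- S :+ (:- T :+ i) := :- (S :+ T) :+ i) refl S T (ι m)) ⟩
  poch (- T) m * poch/fact (- (S + T) + ι m) m * fact⁻¹ m * poch/fact (- (R + S + T) + ι (m ℕ.+ m)) m
    ∎
  where open ≡-Reasoning

diagonal-closed-form₂ : ∀ R S m →
  Diag (onePlusPow (zero3 ⊖ X) R ⊗ (onePlusPow ((zero3 ⊖ X) ⊖ scale (+ 2 / 1) Y) S
    ⊗ onePlusPow (((zero3 ⊖ X) ⊖ Y) ⊖ Z) (- 1ℚ))) m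
    ≡ powQ (+ 4 / 1) m * poch ((+ 1 / 2) * (1ℚ - S)) m * fact⁻¹ m * poch/fact (1ℚ - (R + S) + ι (m ℕ.+ m)) m
diagonal-closed-form₂ R S m = begin
  Diag (onePlusPow (zero3 ⊖ X) R ⊗ (onePlusPow ((zero3 ⊖ X) ⊖ scale (+ 2 / 1) Y) S
    ⊗ onePlusPow (((zero3 ⊖ X) ⊖ Y) ⊖ Z) (- 1ℚ))) m
    ≡⟨ diagonal-coefficient (+ 2 / 1) R S (- 1ℚ) [-x]≗lin ([-x-βy]≗lin (+ 2 / 1)) [-x-y-z]≗lin m ⟩
  diagSum (- S) 1ℚ (+ 2 / 1) m * fact⁻¹ m * poch/fact (- R + (- S + 1ℚ + ι (m ℕ.+ m))) m
    ≡⟨ cong₂ (λ d w → d * fact⁻¹ m * poch/fact w m)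
         (diagSum-double (- S) _ (solve 1 (λ S → con (+ 2 / 1) :* (con (+ 1 / 2) :* (con 1ℚ :- S)) := :- S :+ con 1ℚ) refl S) m)
         (solve 3 (λ R S i → :- R :+ (:- S :+ con 1ℚ :+ i) := con 1ℚ :- (R :+ S) :+ i) refl R S (ι (m ℕ.+ m))) ⟩
  powQ (+ 4 / 1) m * poch ((+ 1 / 2) * (1ℚ - S)) m * fact⁻¹ m * poch/fact (1ℚ - (R + S) + ι (m ℕ.+ m)) m
    ∎
  where open ≡-Reasoning

diagonal-₆F₅ : (R S T : ℚ) →
    (HypDefined ((+ 1 / 2) * (- (R + S + T)) ∷ (+ 1 / 2) * (1ℚ - (R + S + T)) ∷ - (S + T) ∷ 1ℚ ∷ 1ℚ ∷ [])
      → (m : ℕ) →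
        Diag (onePlusPow (zero3 ⊖ X) R
               ⊗ (onePlusPow ((zero3 ⊖ X) ⊖ Y) S
               ⊗ onePlusPow (((zero3 ⊖ X) ⊖ Y) ⊖ Z) T)) m
        ≡ HypF ((+ 1 / 3) * (- (R + S + T)) ∷ (+ 1 / 3) * (1ℚ - (R + S + T))
                  ∷ (+ 1 / 3) * ((+ 2 / 1) - (R + S + T)) ∷ (+ 1 / 2) * (- (S + T))
                  ∷ (+ 1 / 2) * (1ℚ - (S + T)) ∷ - T ∷ [])
               ((+ 1 / 2) * (- (R + S + T)) ∷ (+ 1 / 2) * (1ℚ - (R + S + T)) ∷ - (S + T) ∷ 1ℚ ∷ 1ℚ ∷ [])
               (+ 27 / 1) m)
diagonal-₆F₅ R S T defined m = HypF-intro as _ (+ 27 / 1) m defined (begin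
  diagonal * Q′ (poch 1ℚ m)
    ≡⟨ cong₂ (λ d f → d * Q′ f) (diagonal-closed-form₁ R S T m) (poch-1 m) ⟩
  poch (- T) m * poch/fact u m * I * poch/fact v m * (b₁ * (b₂ * (poch U m * (F * (F * 1ℚ)))) * F)
    ≡⟨ solve 8 (λ t u v b₁ b₂ pU F I → t :* (u :* I) :* I :* (v :* I) :* (b₁ :* (b₂ :* (pU :* (F :* (F :* con 1ℚ)))) :* F)
                                   := t :* (pU :* u) :* (v :* (b₁ :* b₂)) :* ((I :* F) :* (I :* F) :* (I :* F))) refl
         (poch (- T) m) (poch u m) (poch v m) b₁ b₂ (poch U m) F I ⟩
  poch (- T) m * (poch U m * poch u m) * (poch v m * (b₁ * b₂)) * ((I * F) * (I * F) * (I * F))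
    ≡⟨ cong₂ (λ x y → poch (- T) m * x * (poch v m * (b₁ * b₂)) * (y * y * y))
         (trans (sym (poch-+ U m m)) (poch-double U _ _ d₄ d₅ m)) (fact⁻¹*fact≡1 m) ⟩
  poch (- T) m * (powQ (+ 4 / 1) m * (a₄ * a₅)) * (poch v m * (b₁ * b₂)) * (1ℚ * 1ℚ * 1ℚ)
    ≡⟨ solve 7 (λ t P x y v b c → t :* (P :* (x :* y)) :* (v :* (b :* c)) :* (con 1ℚ :* con 1ℚ :* con 1ℚ)
                                := t :* x :* y :* (v :* (P :* (b :* c)))) refl
         (poch (- T) m) (powQ (+ 4 / 1) m) a₄ a₅ (poch v m) b₁ b₂ ⟩
  poch (- T) m * a₄ * a₅ * (poch v m * (powQ (+ 4 / 1) m * (b₁ * b₂)))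
    ≡⟨ cong (poch (- T) m * a₄ * a₅ *_) (poch-upper-third V _ _ _ _ _ e₁ e₂ e₃ d₁ d₂ m) ⟩
  poch (- T) m * a₄ * a₅ * (powQ (+ 27 / 1) m * (a₁ * a₂ * a₃))
    ≡⟨ solve 7 (λ t x y P a b c → t :* x :* y :* (P :* (a :* b :* c)) := a :* (b :* (c :* (x :* (y :* (t :* con 1ℚ))))) :* P)
         refl (poch (- T) m) a₄ a₅ (powQ (+ 27 / 1) m) a₁ a₂ a₃ ⟩
  a₁ * (a₂ * (a₃ * (a₄ * (a₅ * (poch (- T) m * 1ℚ))))) * powQ (+ 27 / 1) m
    ∎)
  where
  open ≡-Reasoning
  diagonal = Diag (onePlusPow (zero3 ⊖ X) R ⊗ (onePlusPow ((zero3 ⊖ X) ⊖ Y) S ⊗ onePlusPow (((zero3 ⊖ X) ⊖ Y) ⊖ Z) T)) m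
  U = - (S + T)
  V = - (R + S + T)
  u = U + ι m
  v = V + ι (m ℕ.+ m)
  F = fact m
  I = fact⁻¹ m
  a₁ = poch ((+ 1 / 3) * V) m
  a₂ = poch ((+ 1 / 3) * (1ℚ - (R + S + T))) m
  a₃ = poch ((+ 1 / 3) * ((+ 2 / 1) - (R + S + T))) m
  a₄ = poch ((+ 1 / 2) * U) m
  a₅ = poch ((+ 1 / 2) * (1ℚ - (S + T))) m
  b₁ = poch ((+ 1 / 2) * V) m
  b₂ = poch ((+ 1 / 2) * (1ℚ - (R + S + T))) m
  as = (+ 1 / 3) * V ∷ (+ 1 / 3) * (1ℚ - (R + S + T)) ∷ (+ 1 / 3) * ((+ 2 / 1) - (R + S + T))
       ∷ (+ 1 / 2) * U ∷ (+ 1 / 2) * (1ℚ - (S + T)) ∷ - T ∷ []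
  Q′ : ℚ → ℚ
  Q′ f = b₁ * (b₂ * (poch U m * (f * (f * 1ℚ)))) * F
  d₁ : (+ 2 / 1) * ((+ 1 / 2) * V) ≡ V
  d₁ = solve 1 (λ x → con (+ 2 / 1) :* (con (+ 1 / 2) :* (:- x)) := :- x) refl (R + S + T)
  d₂ : (+ 2 / 1) * ((+ 1 / 2) * (1ℚ - (R + S + T))) ≡ V + 1ℚ
  d₂ = solve 1 (λ x → con (+ 2 / 1) :* (con (+ 1 / 2) :* (con 1ℚ :- x)) := :- x :+ con 1ℚ) refl (R + S + T)
  d₄ : (+ 2 / 1) * ((+ 1 / 2) * U) ≡ U
  d₄ = solve 1 (λ x → con (+ 2 / 1) :* (con (+ 1 / 2) :* (:- x)) := :- x) refl (S + T)
  d₅ : (+ 2 / 1) * ((+ 1 / 2) * (1ℚ - (S + T))) ≡ U + 1ℚ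
  d₅ = solve 1 (λ x → con (+ 2 / 1) :* (con (+ 1 / 2) :* (con 1ℚ :- x)) := :- x :+ con 1ℚ) refl (S + T)
  e₁ : (+ 3 / 1) * ((+ 1 / 3) * V) ≡ V
  e₁ = solve 1 (λ x → con (+ 3 / 1) :* (con (+ 1 / 3) :* (:- x)) := :- x) refl (R + S + T)
  e₂ : (+ 3 / 1) * ((+ 1 / 3) * (1ℚ - (R + S + T))) ≡ V + 1ℚ
  e₂ = solve 1 (λ x → con (+ 3 / 1) :* (con (+ 1 / 3) :* (con 1ℚ :- x)) := :- x :+ con 1ℚ) refl (R + S + T)
  e₃ : (+ 3 / 1) * ((+ 1 / 3) * ((+ 2 / 1) - (R + S + T))) ≡ V + (+ 2 / 1)
  e₃ = solve 1 (λ x → con (+ 3 / 1) :* (con (+ 1 / 3) :* (con (+ 2 / 1) :- x)) := :- x :+ con (+ 2 / 1)) refl (R + S + T)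

diagonal-₄F₃ : (R S : ℚ) →
    (HypDefined ((+ 1 / 2) * (1ℚ - (R + S)) ∷ (+ 1 / 2) * ((+ 2 / 1) - (R + S)) ∷ 1ℚ ∷ [])
      → (m : ℕ) →
        Diag (onePlusPow (zero3 ⊖ X) R
               ⊗ (onePlusPow ((zero3 ⊖ X) ⊖ scale (+ 2 / 1) Y) S
               ⊗ onePlusPow (((zero3 ⊖ X) ⊖ Y) ⊖ Z) (- 1ℚ))) m
        ≡ HypF ((+ 1 / 3) * (1ℚ - (R + S)) ∷ (+ 1 / 3) * ((+ 2 / 1) - (R + S))
                  ∷ (+ 1 / 3) * ((+ 3 / 1) - (R + S)) ∷ (+ 1 / 2) * (1ℚ - S) ∷ [])
               ((+ 1 / 2) * (1ℚ - (R + S)) ∷ (+ 1 / 2) * ((+ 2 / 1) - (R + S)) ∷ 1ℚ ∷ [])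
               (+ 27 / 1) m)
diagonal-₄F₃ R S defined m = HypF-intro as _ (+ 27 / 1) m defined (begin
  diagonal * Q′ (poch 1ℚ m)
    ≡⟨ cong₂ (λ d f → d * Q′ f) (diagonal-closed-form₂ R S m) (poch-1 m) ⟩
  powQ (+ 4 / 1) m * a₄ * I * poch/fact v m * (b₁ * (b₂ * (F * 1ℚ)) * F)
    ≡⟨ solve 7 (λ P a v b c F I → P :* a :* I :* (v :* I) :* (b :* (c :* (F :* con 1ℚ)) :* F)
                                := a :* (v :* (P :* (b :* c))) :* ((I :* F) :* (I :* F))) refl
         (powQ (+ 4 / 1) m) a₄ (poch v m) b₁ b₂ F I ⟩
  a₄ * (poch v m * (powQ (+ 4 / 1) m * (b₁ * b₂))) * ((I * F) * (I * F))
    ≡⟨ cong₂ (λ x y → a₄ * x * (y * y)) (poch-upper-third V _ _ _ _ _ e₁ e₂ e₃ d₁ d₂ m) (fact⁻¹*fact≡1 m) ⟩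
  a₄ * (powQ (+ 27 / 1) m * (a₁ * a₂ * a₃)) * (1ℚ * 1ℚ)
    ≡⟨ solve 5 (λ x P a b c → x :* (P :* (a :* b :* c)) :* (con 1ℚ :* con 1ℚ) := a :* (b :* (c :* (x :* con 1ℚ))) :* P)
         refl a₄ (powQ (+ 27 / 1) m) a₁ a₂ a₃ ⟩
  a₁ * (a₂ * (a₃ * (a₄ * 1ℚ))) * powQ (+ 27 / 1) m
    ∎)
  where
  open ≡-Reasoning
  diagonal = Diag (onePlusPow (zero3 ⊖ X) R ⊗ (onePlusPow ((zero3 ⊖ X) ⊖ scale (+ 2 / 1) Y) S
                    ⊗ onePlusPow (((zero3 ⊖ X) ⊖ Y) ⊖ Z) (- 1ℚ))) m
  V = 1ℚ - (R + S)
  v = V + ι (m ℕ.+ m)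
  F = fact m
  I = fact⁻¹ m
  a₁ = poch ((+ 1 / 3) * V) m
  a₂ = poch ((+ 1 / 3) * ((+ 2 / 1) - (R + S))) m
  a₃ = poch ((+ 1 / 3) * ((+ 3 / 1) - (R + S))) m
  a₄ = poch ((+ 1 / 2) * (1ℚ - S)) m
  b₁ = poch ((+ 1 / 2) * V) m
  b₂ = poch ((+ 1 / 2) * ((+ 2 / 1) - (R + S))) m
  as = (+ 1 / 3) * V ∷ (+ 1 / 3) * ((+ 2 / 1) - (R + S)) ∷ (+ 1 / 3) * ((+ 3 / 1) - (R + S)) ∷ (+ 1 / 2) * (1ℚ - S) ∷ []
  Q′ : ℚ → ℚ
  Q′ f = b₁ * (b₂ * (f * 1ℚ)) * F
  d₁ : (+ 2 / 1) * ((+ 1 / 2) * V) ≡ V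
  d₁ = solve 1 (λ x → con (+ 2 / 1) :* (con (+ 1 / 2) :* (con 1ℚ :- x)) := con 1ℚ :- x) refl (R + S)
  d₂ : (+ 2 / 1) * ((+ 1 / 2) * ((+ 2 / 1) - (R + S))) ≡ V + 1ℚ
  d₂ = solve 1 (λ x → con (+ 2 / 1) :* (con (+ 1 / 2) :* (con (+ 2 / 1) :- x)) := con 1ℚ :- x :+ con 1ℚ) refl (R + S)
  e₁ : (+ 3 / 1) * ((+ 1 / 3) * V) ≡ V
  e₁ = solve 1 (λ x → con (+ 3 / 1) :* (con (+ 1 / 3) :* (con 1ℚ :- x)) := con 1ℚ :- x) refl (R + S)
  e₂ : (+ 3 / 1) * ((+ 1 / 3) * ((+ 2 / 1) - (R + S))) ≡ V + 1ℚ
  e₂ = solve 1 (λ x → con (+ 3 / 1) :* (con (+ 1 / 3) :* (con (+ 2 / 1) :- x)) := con 1ℚ :- x :+ con 1ℚ) refl (R + S)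
  e₃ : (+ 3 / 1) * ((+ 1 / 3) * ((+ 3 / 1) - (R + S))) ≡ V + (+ 2 / 1)
  e₃ = solve 1 (λ x → con (+ 3 / 1) :* (con (+ 1 / 3) :* (con (+ 3 / 1) :- x)) := con 1ℚ :- x :+ con (+ 2 / 1)) refl (R + S)

theorem2 : (R S T : ℚ) →
    (HypDefined ((+ 1 / 2) * (- (R + S + T)) ∷ (+ 1 / 2) * (1ℚ - (R + S + T)) ∷ - (S + T) ∷ 1ℚ ∷ 1ℚ ∷ [])
      → (m : ℕ) →
        Diag (onePlusPow (zero3 ⊖ X) R
               ⊗ (onePlusPow ((zero3 ⊖ X) ⊖ Y) S
               ⊗ onePlusPow (((zero3 ⊖ X) ⊖ Y) ⊖ Z) T)) m
        ≡ HypF ((+ 1 / 3) * (- (R + S + T)) ∷ (+ 1 / 3) * (1ℚ - (R + S + T))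
                  ∷ (+ 1 / 3) * ((+ 2 / 1) - (R + S + T)) ∷ (+ 1 / 2) * (- (S + T))
                  ∷ (+ 1 / 2) * (1ℚ - (S + T)) ∷ - T ∷ [])
               ((+ 1 / 2) * (- (R + S + T)) ∷ (+ 1 / 2) * (1ℚ - (R + S + T)) ∷ - (S + T) ∷ 1ℚ ∷ 1ℚ ∷ [])
               (+ 27 / 1) m)
    ×
    (HypDefined ((+ 1 / 2) * (1ℚ - (R + S)) ∷ (+ 1 / 2) * ((+ 2 / 1) - (R + S)) ∷ 1ℚ ∷ [])
      → (m : ℕ) →
        Diag (onePlusPow (zero3 ⊖ X) R
               ⊗ (onePlusPow ((zero3 ⊖ X) ⊖ scale (+ 2 / 1) Y) S
               ⊗ onePlusPow (((zero3 ⊖ X) ⊖ Y) ⊖ Z) (- 1ℚ))) m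
        ≡ HypF ((+ 1 / 3) * (1ℚ - (R + S)) ∷ (+ 1 / 3) * ((+ 2 / 1) - (R + S))
                  ∷ (+ 1 / 3) * ((+ 3 / 1) - (R + S)) ∷ (+ 1 / 2) * (1ℚ - S) ∷ [])
               ((+ 1 / 2) * (1ℚ - (R + S)) ∷ (+ 1 / 2) * ((+ 2 / 1) - (R + S)) ∷ 1ℚ ∷ [])
               (+ 27 / 1) m)
theorem2 R S T = diagonal-₆F₅ R S T , diagonal-₄F₃ R S
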